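{- Let $G$ be a finite simple undirected graph, $\mathcal{M}$ an MCB of $G$, and $C_1,C_2\in\mathcal{M}$ distinct with $|C_1|\le|C_2|$, such that $C_1$ and $C_2$ share at least one vertex. Then there exist circulations (cyclic traversal directions) of $C_1$ and $C_2$ such that: (1) the intersection of $C_1$ and $C_2$ (common vertices and edges) consists of $k\ge1$ vertex-disjoint paths $P_1,P_2,\ldots,P_k$ (a path may consist of a single vertex) which appear in the same cyclic order and with the same orientation in both traversals; (2) for $i=1,\ldots,k$ and $j=1,2$, letting $Q_i^{(j)}$ be the path in $C_j$ (traversed in the chosen direction) joining the end of $P_i$ to the start of $P_{i+1}$, where $P_{k+1}:=P_1$, the paths can be labeled so that $|Q_i^{(1)}|=|Q_i^{(2)}|$ for $i=1,\ldots,k-1$; $|Q_i^{(j)}|\le|C_1|/2$ for $i=1,\ldots,k-1$, $j=1,2$; $|Q_k^{(2)}|=|Q_k^{(1)}|+|C_2|-|C_1|$; and $|Q_k^{(j)}|\ge|C_j|/2$ for $j=1,2$.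
   Context: Let $G=(V,E)$ be a finite simple undirected graph. A cycle is a set $C\subseteq E$ such that every vertex of $G$ has even degree in the subgraph with edge set $C$; $|C|$ denotes the number of edges, and the length of a path is its number of edges (a single-vertex path has length $0$). The cycles form a vector space over $GF(2)$ under symmetric difference $\oplus$. A minimum cycle basis (MCB) is a basis $\mathcal{M}$ of this space minimizing $\sum_{B\in\mathcal{M}}|B|$. Elements of an MCB are edge sets of simple cycles (circuits) of $G$, and we regard them as cycle graphs. -}

module Defs where

open import Data.Nat using (ℕ; zero; suc; _+_; _*_; _∸_; _≤_; _<_)
open import Data.Nat.Divisibility using (_∣_)
open import Data.Bool using (Bool; true; false; _∧_; _xor_; if_then_else_)
open import Data.Fin using (Fin; toℕ)
open import Data.Fin.Properties using () renaming (_<?_ to _<ᶠ?_)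
open import Data.List using (List; map; foldr; allFin)
open import Data.Nat.ListAction using (sum)
open import Data.Product using (Σ; ∃; ∃-syntax; _×_; _,_)
open import Data.Sum using (_⊎_)
open import Relation.Nullary using (does)
open import Relation.Binary.PropositionalEquality using (_≡_)

record Graph : Set where
  field
    n      : ℕ
    adj    : Fin n → Fin n → Bool
    sym    : ∀ u v → adj u v ≡ adj v u
    irrefl : ∀ v → adj v v ≡ false
open Graph public

-- An edge set over vertex set Fin n, given as a (intended symmetric)
-- Boolean relation: S u v ≡ true means the edge {u,v} is in S.
EdgeSet : ℕ → Set
EdgeSet n = Fin n → Fin n → Bool

IsEdgeSet : (G : Graph) → EdgeSet (n G) → Set
IsEdgeSet G S = (∀ u v → S u v ≡ S v u) × (∀ u v → S u v ≡ true → adj G u v ≡ true)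

count : ∀ {n} → (Fin n → Bool) → ℕ
count {n} p = sum (map (λ i → if p i then 1 else 0) (allFin n))

size : ∀ {n} → EdgeSet n → ℕ
size {n} S = sum (map (λ u → count (λ v → does (u <ᶠ? v) ∧ S u v)) (allFin n))

deg : ∀ {n} → EdgeSet n → Fin n → ℕ
deg S v = count (S v)

-- a cycle (element of the cycle space): edge set of G with all degrees even
IsCycle : (G : Graph) → EdgeSet (n G) → Set
IsCycle G C = IsEdgeSet G C × (∀ v → 2 ∣ deg C v)

comb : ∀ {n m} → (Fin m → Bool) → (Fin m → EdgeSet n) → EdgeSet n
comb {m = m} c B u v = foldr _xor_ false (map (λ i → c i ∧ B i u v) (allFin m))

IsBasis : (G : Graph) {m : ℕ} → (Fin m → EdgeSet (n G)) → Set
IsBasis G {m} B =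
  (∀ i → IsCycle G (B i)) ×
  (∀ (c : Fin m → Bool) → (∀ u v → comb c B u v ≡ false) → ∀ i → c i ≡ false) ×
  (∀ (C : EdgeSet (n G)) → IsCycle G C → ∃[ c ] (∀ u v → comb c B u v ≡ C u v))

weight : ∀ {n m} → (Fin m → EdgeSet n) → ℕ
weight {m = m} B = sum (map (λ i → size (B i)) (allFin m))

IsMCB : (G : Graph) {m : ℕ} → (Fin m → EdgeSet (n G)) → Set
IsMCB G B = IsBasis G B × (∀ {m'} (B' : Fin m' → EdgeSet (n G)) → IsBasis G B' → weight B ≤ weight B')

OnCycle : ∀ {n} → EdgeSet n → Fin n → Set
OnCycle C v = ∃[ u ] (C v u ≡ true)

-- Circulations: a cyclic traversal w 0, w 1, …, w (L-1), w L = w 0, …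
-- of L ≥ 3 distinct vertices whose consecutive pairs are exactly the edges of C.

IsCirculation : ∀ {n} → EdgeSet n → (L : ℕ) → (ℕ → Fin n) → Set
IsCirculation C L w =
  (3 ≤ L) ×
  (∀ t → w (t + L) ≡ w t) ×
  (∀ t t' → t < L → t' < L → w t ≡ w t' → t ≡ t') ×
  (∀ u v → (C u v ≡ true →
              ∃[ t ] (t < L × ((w t ≡ u × w (suc t) ≡ v) ⊎ (w t ≡ v × w (suc t) ≡ u))))
         × (∃[ t ] (t < L × ((w t ≡ u × w (suc t) ≡ v) ⊎ (w t ≡ v × w (suc t) ≡ u)))
              → C u v ≡ true))

sumTo : ℕ → (ℕ → ℕ) → ℕ
sumTo zero    f = 0
sumTo (suc k) f = sumTo k f + f k

-- Conclusion of Theorem 3.  Paths are indexed 0,…,k-1 (paper: 1,…,k).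
-- P_i is the segment w₁ (a i), w₁ (a i + 1), …, w₁ (a i + ℓ i) of the first
-- traversal, equal (same orientation) to w₂ (b i), …, w₂ (b i + ℓ i).
-- Q_i^{(j)} is the segment of traversal j from the end of P_i to the start
-- of P_{i+1}; its length is q₁ i resp. q₂ i.  The layout equations say the
-- P's and Q's follow each other in this cyclic order, going once around.

record Structure {n} (C₁ C₂ : EdgeSet n) : Set where
  field
    L₁ L₂  : ℕ
    w₁ w₂  : ℕ → Fin n
    circ₁  : IsCirculation C₁ L₁ w₁
    circ₂  : IsCirculation C₂ L₂ w₂
    k      : ℕ
    k≥1    : 1 ≤ k
    a b ℓ  : ℕ → ℕ
    q₁ q₂  : ℕ → ℕ
    agree  : ∀ i t → i < k → t ≤ ℓ i → w₁ (a i + t) ≡ w₂ (b i + t)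
    disj   : ∀ i i' t t' → i < k → i' < k → t ≤ ℓ i → t' ≤ ℓ i' →
             w₁ (a i + t) ≡ w₁ (a i' + t') → (i ≡ i' × t ≡ t')
    -- same cyclic order in both traversals; Q's join consecutive P's
    layout₁ : ∀ i → suc i < k → a (suc i) ≡ a i + ℓ i + q₁ i
    total₁  : sumTo k (λ i → ℓ i + q₁ i) ≡ L₁
    layout₂ : ∀ i → suc i < k → b (suc i) ≡ b i + ℓ i + q₂ i
    total₂  : sumTo k (λ i → ℓ i + q₂ i) ≡ L₂
    vertices : ∀ v → ((OnCycle C₁ v × OnCycle C₂ v) →
                        ∃[ i ] ∃[ t ] (i < k × t ≤ ℓ i × w₁ (a i + t) ≡ v))
                   × (∃[ i ] ∃[ t ] (i < k × t ≤ ℓ i × w₁ (a i + t) ≡ v) →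
                        (OnCycle C₁ v × OnCycle C₂ v))
    edges : ∀ u v → ((C₁ u v ≡ true × C₂ u v ≡ true) →
                        ∃[ i ] ∃[ t ] (i < k × t < ℓ i ×
                          ((w₁ (a i + t) ≡ u × w₁ (a i + suc t) ≡ v)
                           ⊎ (w₁ (a i + t) ≡ v × w₁ (a i + suc t) ≡ u))))
                  × (∃[ i ] ∃[ t ] (i < k × t < ℓ i ×
                          ((w₁ (a i + t) ≡ u × w₁ (a i + suc t) ≡ v)
                           ⊎ (w₁ (a i + t) ≡ v × w₁ (a i + suc t) ≡ u))) →
                        (C₁ u v ≡ true × C₂ u v ≡ true))
    -- length conditions (i = 1,…,k-1 in the paper ↔ suc i < k here;
    -- Q_k ↔ index k ∸ 1)
    eqLen   : ∀ i → suc i < k → q₁ i ≡ q₂ i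
    short₁  : ∀ i → suc i < k → 2 * q₁ i ≤ size C₁
    short₂  : ∀ i → suc i < k → 2 * q₂ i ≤ size C₁
    lastLen : q₂ (k ∸ 1) ≡ q₁ (k ∸ 1) + (size C₂ ∸ size C₁)
    long₁   : size C₁ ≤ 2 * q₁ (k ∸ 1)
    long₂   : size C₂ ≤ 2 * q₂ (k ∸ 1)

{-# OPTIONS --safe #-}
module Submission where

-- Fix circulations w₁, w₂ of C₁, C₂. By the exchange property of a minimum basis, every cycle whose
-- representation contains C₁ has length ≥ |C₁|, and C₂ is isometric: a C₁-segment joining two vertices
-- of C₂ is at least as long as one of the two C₂-arcs between them. Walk once around C₁ and lift each gap
-- between consecutive common vertices to such a short C₂-arc. The resulting gap cycles sum to C₁ ⊕ (∅ or C₂),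
-- so the representation of one of them, closing a gap of length δ, contains C₁. Closing that gap with any
-- other C₂-arc changes its cycle by ∅ or C₂, so every C₂-arc between the ends of the gap has length
-- ≥ M = |C₁| − δ; with isometry this gives 2M ≤ |C₁| and 2M ≤ |C₂|. Lifting the remaining M steps of C₁
-- moves at most M along C₂ but must span such an arc, so all lifts go the same way by exactly the C₁-distance:
-- after rotating or reflecting w₂ both traversals agree at every common vertex. The maximal runs of common
-- edges are the paths Pᵢ, the gaps between them the Qᵢ, the last one containing the long gap.

open import Algebra.Bundles using (CommutativeRing)
open import Data.Bool using (Bool; true; false; _∧_; _xor_; if_then_else_)
open import Data.Bool.Properties
  using (xor-assoc; xor-comm; xor-same; xor-identityʳ; xor-∧-commutativeRing;
         ∧-assoc; ∧-comm; ∧-identityʳ; ∧-zeroʳ; ∧-distribʳ-xor;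
         ∧-conicalˡ; ∧-conicalʳ)
  renaming (_≟_ to _≟ᵇ_)
open import Data.Empty using (⊥; ⊥-elim)
open import Data.Fin as Fin using (Fin; toℕ)
import Data.Fin.Properties as Finₚ
open import Data.List using (_∷_; map; foldr; allFin)
open import Data.List.Properties using (map-tabulate)
open import Data.Nat
open import Data.Nat.DivMod
open import Data.Nat.Divisibility using (_∣_; divides; ∣m+n∣m⇒∣n; ∣1⇒≡1; m∣m*n)
open import Data.Nat.ListAction using (sum)
open import Data.Nat.Solver using (module +-*-Solver)
open import Data.Nat.Properties
open import Data.Product using (∃-syntax; _×_; _,_; proj₁; proj₂)
open import Data.Sum using (_⊎_; inj₁; inj₂; [_,_]′)
open import Data.Vec.Functional using (updateAt)
open import Data.Vec.Functional.Properties using (updateAt-updates; updateAt-minimal)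
open import Function using (_∘_; id)
open import Relation.Nullary using (¬_; ¬?; _×-dec_; Dec; yes; no; does)
open import Relation.Nullary.Decidable using (dec-true; dec-false)
open import Relation.Binary.PropositionalEquality
open import Relation.Binary.Definitions using (tri<; tri≈; tri>)
open import Defs hiding (sym)

open import Algebra.Properties.CommutativeSemigroup
  (CommutativeRing.+-commutativeSemigroup xor-∧-commutativeRing)
  using () renaming (interchange to xor-interchange)
open import Algebra.Properties.CommutativeSemigroup +-commutativeSemigroup
  using () renaming (interchange to +-interchange; xy∙z≈xz∙y to +-right-comm)

infix 4 _=ᶠ_
_=ᶠ_ : ∀ {n} → Fin n → Fin n → Bool
i =ᶠ j = does (i Finₚ.≟ j)

=ᶠ-refl : ∀ {n} (i : Fin n) → (i =ᶠ i) ≡ true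
=ᶠ-refl i = dec-true (i Finₚ.≟ i) refl

=ᶠ-≢ : ∀ {n} {i j : Fin n} → i ≢ j → (i =ᶠ j) ≡ false
=ᶠ-≢ {i = i} {j} = dec-false (i Finₚ.≟ j)

=ᶠ⇒≡ : ∀ {n} {i j : Fin n} → (i =ᶠ j) ≡ true → i ≡ j
=ᶠ⇒≡ {i = i} {j} eq with i Finₚ.≟ j | eq
... | yes i≡j | _ = i≡j

xor-cancelˡ : ∀ a b → a xor (a xor b) ≡ b
xor-cancelˡ a b = trans (sym (xor-assoc a a b)) (cong (_xor b) (xor-same a))

xor-cancelʳ : ∀ a b → (a xor b) xor b ≡ a
xor-cancelʳ a b = trans (xor-assoc a b b) (trans (cong (a xor_) (xor-same b)) (xor-identityʳ a))

xor-cancel-middle : ∀ a b c → (a xor b) xor (b xor c) ≡ a xor c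
xor-cancel-middle a b c = trans (xor-assoc a b (b xor c)) (cong (a xor_) (xor-cancelˡ b c))

xor-cancel-left : ∀ a b c → (a xor b) xor (a xor c) ≡ b xor c
xor-cancel-left a b c = trans (cong (_xor (a xor c)) (xor-comm a b)) (xor-cancel-middle b a c)

xor-false⇒≡ : ∀ a b → a xor b ≡ false → a ≡ b
xor-false⇒≡ true  true  _ = refl
xor-false⇒≡ false false _ = refl

≡true⇔⇒≡ : ∀ {a b} → (a ≡ true → b ≡ true) → (b ≡ true → a ≡ true) → a ≡ b
≡true⇔⇒≡ {true}  a⇒b _   = sym (a⇒b refl)
≡true⇔⇒≡ {false} {true}  _ b⇒a = b⇒a refl
≡true⇔⇒≡ {false} {false} _ _   = refl

xor-true : ∀ a b → a xor b ≡ true → a ≡ true ⊎ b ≡ true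
xor-true true  b _  = inj₁ refl
xor-true false b eq = inj₂ eq

map-allFin-suc : ∀ {A : Set} {n} (f : Fin (suc n) → A) →
                 map f (allFin (suc n)) ≡ f Fin.zero ∷ map (f ∘ Fin.suc) (allFin n)
map-allFin-suc f = trans (map-tabulate id f) (cong (f Fin.zero ∷_) (sym (map-tabulate id (f ∘ Fin.suc))))

sumF : ∀ {n} → (Fin n → ℕ) → ℕ
sumF {n} f = sum (map f (allFin n))

sumF-suc : ∀ {n} (f : Fin (suc n) → ℕ) → sumF f ≡ f Fin.zero + sumF (f ∘ Fin.suc)
sumF-suc f = cong sum (map-allFin-suc f)

sumF-cong : ∀ {n} {f g : Fin n → ℕ} → (∀ i → f i ≡ g i) → sumF f ≡ sumF g
sumF-cong {zero}  f≗g = refl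
sumF-cong {suc n} {f} {g} f≗g = begin
  sumF f                              ≡⟨ sumF-suc f ⟩
  f Fin.zero + sumF (f ∘ Fin.suc)     ≡⟨ cong₂ _+_ (f≗g Fin.zero) (sumF-cong (f≗g ∘ Fin.suc)) ⟩
  g Fin.zero + sumF (g ∘ Fin.suc)     ≡⟨ sumF-suc g ⟨
  sumF g                              ∎
  where open ≡-Reasoning

sumF-mono : ∀ {n} {f g : Fin n → ℕ} → (∀ i → f i ≤ g i) → sumF f ≤ sumF g
sumF-mono {zero}  f≤g = z≤n
sumF-mono {suc n} {f} {g} f≤g rewrite sumF-suc f | sumF-suc g =
  +-mono-≤ (f≤g Fin.zero) (sumF-mono (f≤g ∘ Fin.suc))

sumF-+ : ∀ {n} (f g : Fin n → ℕ) → sumF (λ i → f i + g i) ≡ sumF f + sumF g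
sumF-+ {zero}  f g = refl
sumF-+ {suc n} f g
  rewrite sumF-suc (λ i → f i + g i) | sumF-suc f | sumF-suc g | sumF-+ (f ∘ Fin.suc) (g ∘ Fin.suc) =
  +-interchange (f Fin.zero) (g Fin.zero) _ _

sumF-zero : ∀ {n} (f : Fin n → ℕ) → (∀ i → f i ≡ 0) → sumF f ≡ 0
sumF-zero {zero}  f f≗0 = refl
sumF-zero {suc n} f f≗0 rewrite sumF-suc f | f≗0 Fin.zero = sumF-zero (f ∘ Fin.suc) (f≗0 ∘ Fin.suc)

sumF-point : ∀ {n} (f : Fin n → ℕ) (i : Fin n) → f i ≤ sumF f
sumF-point f Fin.zero    rewrite sumF-suc f = m≤m+n _ _
sumF-point f (Fin.suc i) rewrite sumF-suc f = ≤-trans (sumF-point (f ∘ Fin.suc) i) (m≤n+m _ _)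

sumF-single : ∀ {n} (f : Fin n → ℕ) (c : Fin n) → (∀ i → i ≢ c → f i ≡ 0) → sumF f ≡ f c
sumF-single f Fin.zero h
  rewrite sumF-suc f | sumF-zero (f ∘ Fin.suc) (λ i → h (Fin.suc i) λ ()) = +-identityʳ _
sumF-single f (Fin.suc c) h
  rewrite sumF-suc f | h Fin.zero (λ ()) = sumF-single (f ∘ Fin.suc) c (λ i i≢c → h (Fin.suc i) (i≢c ∘ Finₚ.suc-injective))

sumF-agree-off : ∀ {n} {f g : Fin n → ℕ} (c : Fin n) → (∀ i → i ≢ c → f i ≡ g i) →
                 sumF f + g c ≡ sumF g + f c
sumF-agree-off {f = f} {g} Fin.zero h
  rewrite sumF-suc f | sumF-suc g | sumF-cong {f = f ∘ Fin.suc} {g ∘ Fin.suc} (λ i → h (Fin.suc i) λ ()) =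
  trans (+-assoc (f Fin.zero) _ (g Fin.zero))
        (trans (+-comm (f Fin.zero) _) (cong (_+ f Fin.zero) (+-comm _ (g Fin.zero))))
sumF-agree-off {f = f} {g} (Fin.suc c) h
  rewrite sumF-suc f | sumF-suc g | h Fin.zero (λ ()) =
  trans (+-assoc (g Fin.zero) _ _)
        (trans (cong (g Fin.zero +_) (sumF-agree-off c (λ i i≢c → h (Fin.suc i) (i≢c ∘ Finₚ.suc-injective))))
               (sym (+-assoc (g Fin.zero) _ _)))

xorF : ∀ {n} → (Fin n → Bool) → Bool
xorF {n} f = foldr _xor_ false (map f (allFin n))

xorF-suc : ∀ {n} (f : Fin (suc n) → Bool) → xorF f ≡ f Fin.zero xor xorF (f ∘ Fin.suc)
xorF-suc f = cong (foldr _xor_ false) (map-allFin-suc f)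

xorF-cong : ∀ {n} {f g : Fin n → Bool} → (∀ i → f i ≡ g i) → xorF f ≡ xorF g
xorF-cong {zero}  f≗g = refl
xorF-cong {suc n} {f} {g} f≗g rewrite xorF-suc f | xorF-suc g =
  cong₂ _xor_ (f≗g Fin.zero) (xorF-cong (f≗g ∘ Fin.suc))

xorF-xor : ∀ {n} (f g : Fin n → Bool) → xorF (λ i → f i xor g i) ≡ xorF f xor xorF g
xorF-xor {zero}  f g = refl
xorF-xor {suc n} f g
  rewrite xorF-suc (λ i → f i xor g i) | xorF-suc f | xorF-suc g | xorF-xor (f ∘ Fin.suc) (g ∘ Fin.suc) =
  xor-interchange (f Fin.zero) (g Fin.zero) _ _

xorF-false : ∀ {n} (f : Fin n → Bool) → (∀ i → f i ≡ false) → xorF f ≡ false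
xorF-false {zero}  f f≗0 = refl
xorF-false {suc n} f f≗0 rewrite xorF-suc f | f≗0 Fin.zero = xorF-false (f ∘ Fin.suc) (f≗0 ∘ Fin.suc)

xorF-single : ∀ {n} (f : Fin n → Bool) (c : Fin n) → (∀ i → i ≢ c → f i ≡ false) → xorF f ≡ f c
xorF-single f Fin.zero h
  rewrite xorF-suc f | xorF-false (f ∘ Fin.suc) (λ i → h (Fin.suc i) λ ()) = xor-identityʳ _
xorF-single f (Fin.suc c) h
  rewrite xorF-suc f | h Fin.zero (λ ()) = xorF-single (f ∘ Fin.suc) c (λ i i≢c → h (Fin.suc i) (i≢c ∘ Finₚ.suc-injective))

xorF-∧ : ∀ {n} (b : Bool) (f : Fin n → Bool) → xorF (λ i → b ∧ f i) ≡ b ∧ xorF f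
xorF-∧ true  f = refl
xorF-∧ false f = xorF-false (λ i → false ∧ f i) (λ _ → refl)

another-true : ∀ {n} (p : Fin n → Bool) {a} → xorF p ≡ false → p a ≡ true → ∃[ b ] (b ≢ a × p b ≡ true)
another-true p {a} even pa with Finₚ.any? (λ b → ¬? (b Finₚ.≟ a) ×-dec (p b ≟ᵇ true))
... | yes found = found
... | no none with trans (sym even) (trans (xorF-single p a only-a) pa)
  where
  only-a : ∀ i → i ≢ a → p i ≡ false
  only-a i i≢a with p i in pi
  ... | false = refl
  ... | true  = ⊥-elim (none (i , i≢a , pi))
... | ()

indicator : Bool → ℕ
indicator b = if b then 1 else 0

count-parity : ∀ {n} (p : Fin n → Bool) → ∃[ h ] count p ≡ indicator (xorF p) + 2 * h
count-parity {zero}  p = 0 , refl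
count-parity {suc n} p with count-parity (p ∘ Fin.suc)
... | h , eq rewrite sumF-suc (indicator ∘ p) | eq | xorF-suc p = step (p Fin.zero) (xorF (p ∘ Fin.suc))
  where
  step : ∀ b c → ∃[ h' ] indicator b + (indicator c + 2 * h) ≡ indicator (b xor c) + 2 * h'
  step false c     = h , refl
  step true  false = h , refl
  step true  true  = suc h , cong suc (sym (+-suc h (h + 0)))

xorF-false⇒even : ∀ {n} (p : Fin n → Bool) → xorF p ≡ false → 2 ∣ count p
xorF-false⇒even p eq with count-parity p
... | h , c rewrite eq = divides h (trans c (*-comm 2 h))

even⇒xorF-false : ∀ {n} (p : Fin n → Bool) → 2 ∣ count p → xorF p ≡ false
even⇒xorF-false p 2∣ with xorF p | count-parity p
... | false | _      = refl
... | true  | h , eq = ⊥-elim (2≢1 (∣1⇒≡1 (∣m+n∣m⇒∣n (subst (2 ∣_) (trans eq (+-comm 1 (2 * h))) 2∣) (m∣m*n h))))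
  where
  2≢1 : 2 ≢ 1
  2≢1 ()

-- Edge sets as vectors over GF(2)

∅ : ∀ {n} → EdgeSet n
∅ u v = false

infixl 6 _⊕_
_⊕_ : ∀ {n} → EdgeSet n → EdgeSet n → EdgeSet n
(S ⊕ T) u v = S u v xor T u v

infix 4 _≐_
_≐_ : ∀ {n} → EdgeSet n → EdgeSet n → Set
S ≐ T = ∀ u v → S u v ≡ T u v

≐-sym : ∀ {n} {S T : EdgeSet n} → S ≐ T → T ≐ S
≐-sym S≐T u v = sym (S≐T u v)

≐-trans : ∀ {n} {S T U : EdgeSet n} → S ≐ T → T ≐ U → S ≐ U
≐-trans S≐T T≐U u v = trans (S≐T u v) (T≐U u v)

arrow : ∀ {n} → Fin n → Fin n → EdgeSet n
arrow x y a b = (a =ᶠ x) ∧ (b =ᶠ y)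

edge : ∀ {n} → Fin n → Fin n → EdgeSet n
edge x y = arrow x y ⊕ arrow y x

edge-sym : ∀ {n} (x y a b : Fin n) → edge x y a b ≡ edge x y b a
edge-sym x y a b = trans (xor-comm (arrow x y a b) (arrow y x a b))
  (cong₂ _xor_ (∧-comm (a =ᶠ y) (b =ᶠ x)) (∧-comm (a =ᶠ x) (b =ᶠ y)))

edge-true : ∀ {n} {x y a b : Fin n} → edge x y a b ≡ true → (a ≡ x × b ≡ y) ⊎ (a ≡ y × b ≡ x)
edge-true {x = x} {y} {a} {b} eq with xor-true (arrow x y a b) (arrow y x a b) eq
... | inj₁ xy = inj₁ (=ᶠ⇒≡ (∧-conicalˡ _ _ xy) , =ᶠ⇒≡ (∧-conicalʳ _ _ xy))
... | inj₂ yx = inj₂ (=ᶠ⇒≡ (∧-conicalˡ _ _ yx) , =ᶠ⇒≡ (∧-conicalʳ _ _ yx))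

edge-self : ∀ {n} {x y : Fin n} → x ≢ y → edge x y x y ≡ true
edge-self {x = x} {y} x≢y rewrite =ᶠ-refl x | =ᶠ-refl y | =ᶠ-≢ x≢y = refl

edge-parity : ∀ {n} (x y a : Fin n) → xorF (edge x y a) ≡ (a =ᶠ x) xor (a =ᶠ y)
edge-parity x y a = trans (xorF-xor (arrow x y a) (arrow y x a)) (cong₂ _xor_ (arrow-parity x y) (arrow-parity y x))
  where
  arrow-parity : ∀ x y → xorF (arrow x y a) ≡ (a =ᶠ x)
  arrow-parity x y = begin
    xorF (λ b → (a =ᶠ x) ∧ (b =ᶠ y))  ≡⟨ xorF-∧ (a =ᶠ x) (_=ᶠ y) ⟩
    (a =ᶠ x) ∧ xorF (_=ᶠ y)            ≡⟨ cong ((a =ᶠ x) ∧_) (trans (xorF-single (_=ᶠ y) y (λ _ → =ᶠ-≢)) (=ᶠ-refl y)) ⟩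
    (a =ᶠ x) ∧ true                    ≡⟨ ∧-identityʳ (a =ᶠ x) ⟩
    (a =ᶠ x)                           ∎
    where open ≡-Reasoning

Step : ∀ {n} → (ℕ → Fin n) → ℕ → Fin n → Fin n → Set
Step f t u v = (f t ≡ u × f (suc t) ≡ v) ⊎ (f t ≡ v × f (suc t) ≡ u)

Step-transport : ∀ {n} (f g : ℕ → Fin n) {a b u v} → f a ≡ g b → f (suc a) ≡ g (suc b) → Step f a u v → Step g b u v
Step-transport f g fa≡gb fa'≡gb' (inj₁ (fa≡u , fa'≡v)) = inj₁ (trans (sym fa≡gb) fa≡u , trans (sym fa'≡gb') fa'≡v)
Step-transport f g fa≡gb fa'≡gb' (inj₂ (fa≡v , fa'≡u)) = inj₂ (trans (sym fa≡gb) fa≡v , trans (sym fa'≡gb') fa'≡u)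

Step-transport-reversed : ∀ {n} (f g : ℕ → Fin n) {a b u v} → f a ≡ g (suc b) → f (suc a) ≡ g b → Step f a u v → Step g b u v
Step-transport-reversed f g fa≡ fa'≡ (inj₁ (fa≡u , fa'≡v)) = inj₂ (trans (sym fa'≡) fa'≡v , trans (sym fa≡) fa≡u)
Step-transport-reversed f g fa≡ fa'≡ (inj₂ (fa≡v , fa'≡u)) = inj₁ (trans (sym fa'≡) fa'≡u , trans (sym fa≡) fa≡v)

steps : ∀ {n} → (ℕ → Fin n) → ℕ → ℕ → EdgeSet n
steps f a zero    = ∅
steps f a (suc m) = steps f a m ⊕ edge (f (a + m)) (f (suc (a + m)))

prefix : ∀ {n} → (ℕ → Fin n) → ℕ → EdgeSet n
prefix f = steps f 0

-- The edges traversed by f between positions a and b, counted mod 2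
-- (so that segments compose by ⊕ regardless of the order of a and b).
segment : ∀ {n} → (ℕ → Fin n) → ℕ → ℕ → EdgeSet n
segment f a b = prefix f a ⊕ prefix f b

edge⇒Step : ∀ {n} (f : ℕ → Fin n) t {u v} → edge (f t) (f (suc t)) u v ≡ true → Step f t u v
edge⇒Step f t eq with edge-true eq
... | inj₁ (u≡ , v≡) = inj₁ (sym u≡ , sym v≡)
... | inj₂ (u≡ , v≡) = inj₂ (sym v≡ , sym u≡)

Step⇒edge : ∀ {n} (f : ℕ → Fin n) t {u v} → f t ≢ f (suc t) → Step f t u v → edge (f t) (f (suc t)) u v ≡ true
Step⇒edge f t ne (inj₁ (refl , refl)) = edge-self ne
Step⇒edge f t ne (inj₂ (refl , refl)) = trans (edge-sym (f t) (f (suc t)) (f (suc t)) (f t)) (edge-self ne)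

steps-parity : ∀ {n} (f : ℕ → Fin n) a m v → xorF (steps f a m v) ≡ (v =ᶠ f a) xor (v =ᶠ f (a + m))
steps-parity f a zero v rewrite +-identityʳ a =
  trans (xorF-false (steps f a zero v) (λ _ → refl)) (sym (xor-same (v =ᶠ f a)))
steps-parity f a (suc m) v = begin
  xorF (steps f a (suc m) v)
    ≡⟨ xorF-xor (steps f a m v) (edge (f (a + m)) (f (suc (a + m))) v) ⟩
  xorF (steps f a m v) xor xorF (edge (f (a + m)) (f (suc (a + m))) v)
    ≡⟨ cong₂ _xor_ (steps-parity f a m v) (edge-parity (f (a + m)) (f (suc (a + m))) v) ⟩
  ((v =ᶠ f a) xor (v =ᶠ f (a + m))) xor ((v =ᶠ f (a + m)) xor (v =ᶠ f (suc (a + m))))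
    ≡⟨ xor-cancel-middle (v =ᶠ f a) _ _ ⟩
  (v =ᶠ f a) xor (v =ᶠ f (suc (a + m)))
    ≡⟨ cong (λ t → (v =ᶠ f a) xor (v =ᶠ f t)) (+-suc a m) ⟨
  (v =ᶠ f a) xor (v =ᶠ f (a + suc m)) ∎
  where open ≡-Reasoning

steps⇒Step : ∀ {n} (f : ℕ → Fin n) a m {u v} → steps f a m u v ≡ true → ∃[ t ] (t < m × Step f (a + t) u v)
steps⇒Step f a (suc m) {u} {v} eq with xor-true (steps f a m u v) _ eq
... | inj₁ earlier = let (t , t<m , step) = steps⇒Step f a m earlier in t , m<n⇒m<1+n t<m , step
... | inj₂ last    = m , ≤-refl , edge⇒Step f (a + m) last

steps-sym : ∀ {n} (f : ℕ → Fin n) a m u v → steps f a m u v ≡ steps f a m v u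
steps-sym f a zero    u v = refl
steps-sym f a (suc m) u v = cong₂ _xor_ (steps-sym f a m u v) (edge-sym _ _ u v)

steps-+ : ∀ {n} (f : ℕ → Fin n) a m m' → steps f a (m + m') ≐ steps f a m ⊕ steps f (a + m) m'
steps-+ f a m zero u v rewrite +-identityʳ m = sym (xor-identityʳ _)
steps-+ f a m (suc m') u v rewrite +-suc m m' | sym (+-assoc a m m') =
  trans (cong (_xor edge (f (a + m + m')) (f (suc (a + m + m'))) u v) (steps-+ f a m m' u v))
        (xor-assoc (steps f a m u v) _ _)

steps-cong : ∀ {n} (f g : ℕ → Fin n) a b m → (∀ t → t ≤ m → f (a + t) ≡ g (b + t)) → steps f a m ≐ steps g b m
steps-cong f g a b zero    f≗g u v = refl
steps-cong f g a b (suc m) f≗g u v =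
  cong₂ _xor_ (steps-cong f g a b m (λ t t≤m → f≗g t (m≤n⇒m≤1+n t≤m)) u v)
              (cong₂ (λ p q → edge p q u v) (f≗g m (n≤1+n m)) shifted)
  where
  shifted : f (suc (a + m)) ≡ g (suc (b + m))
  shifted = trans (cong f (sym (+-suc a m))) (trans (f≗g (suc m) ≤-refl) (cong g (+-suc b m)))

segment-steps : ∀ {n} (f : ℕ → Fin n) a m → segment f a (a + m) ≐ steps f a m
segment-steps f a m u v =
  trans (cong (prefix f a u v xor_) (steps-+ f 0 a m u v)) (xor-cancelˡ (prefix f a u v) (steps f a m u v))

segment-comm : ∀ {n} (f : ℕ → Fin n) a b → segment f a b ≐ segment f b a
segment-comm f a b u v = xor-comm (prefix f a u v) (prefix f b u v)

segment-trans : ∀ {n} (f : ℕ → Fin n) a b c → segment f a b ⊕ segment f b c ≐ segment f a c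
segment-trans f a b c u v = xor-cancel-middle (prefix f a u v) (prefix f b u v) (prefix f c u v)

segment-self : ∀ {n} (f : ℕ → Fin n) a → segment f a a ≐ ∅
segment-self f a u v = xor-same (prefix f a u v)

segment-sym : ∀ {n} (f : ℕ → Fin n) a b u v → segment f a b u v ≡ segment f a b v u
segment-sym f a b u v = cong₂ _xor_ (steps-sym f 0 a u v) (steps-sym f 0 b u v)

segment-parity : ∀ {n} (f : ℕ → Fin n) a b v → xorF (segment f a b v) ≡ (v =ᶠ f a) xor (v =ᶠ f b)
segment-parity f a b v = trans (xorF-xor (prefix f a v) (prefix f b v))
  (trans (cong₂ _xor_ (steps-parity f 0 a v) (steps-parity f 0 b v)) (xor-cancel-left (v =ᶠ f 0) _ _))

segment⇒Step : ∀ {n} (f : ℕ → Fin n) a b {u v} → segment f a b u v ≡ true → ∃[ t ] Step f t u v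
segment⇒Step f a b {u} {v} eq with xor-true (prefix f a u v) _ eq
... | inj₁ in-a = let (t , _ , step) = steps⇒Step f 0 a in-a in t , step
... | inj₂ in-b = let (t , _ , step) = steps⇒Step f 0 b in-b in t , step

lt : ∀ {n} → Fin n → Fin n → Bool
lt u v = does (u Finₚ.<? v)

lt-cmp : ∀ {n} {x y : Fin n} → x ≢ y → (lt x y ≡ true × lt y x ≡ false) ⊎ (lt x y ≡ false × lt y x ≡ true)
lt-cmp {x = x} {y} x≢y with Finₚ.<-cmp x y
... | tri< x<y _ y≮x = inj₁ (dec-true (x Finₚ.<? y) x<y , dec-false (y Finₚ.<? x) y≮x)
... | tri≈ _ x≡y _   = ⊥-elim (x≢y x≡y)
... | tri> x≮y _ y<x = inj₂ (dec-false (x Finₚ.<? y) x≮y , dec-true (y Finₚ.<? x) y<x)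

-- size S unfolds to sumF (λ u → sumF (edgeCount S u)): each edge is counted at its ordered pair u < v.
edgeCount : ∀ {n} → EdgeSet n → Fin n → Fin n → ℕ
edgeCount S u v = indicator (lt u v ∧ S u v)

size-+ : ∀ {n} (S T : EdgeSet n) → sumF (λ u → sumF (λ v → edgeCount S u v + edgeCount T u v)) ≡ size S + size T
size-+ S T = trans (sumF-cong (λ u → sumF-+ (edgeCount S u) (edgeCount T u)))
                   (sumF-+ (λ u → sumF (edgeCount S u)) (λ u → sumF (edgeCount T u)))

size-cong : ∀ {n} {S T : EdgeSet n} → S ≐ T → size S ≡ size T
size-cong S≐T = sumF-cong (λ u → sumF-cong (λ v → cong (λ b → indicator (lt u v ∧ b)) (S≐T u v)))

size-∅ : ∀ {n} → size (∅ {n}) ≡ 0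
size-∅ {n} = sumF-zero (λ u → sumF (edgeCount (∅ {n}) u)) (λ u → sumF-zero (edgeCount ∅ u) (λ v → cong indicator (∧-zeroʳ (lt u v))))

size-⊕≤ : ∀ {n} (S T : EdgeSet n) → size (S ⊕ T) ≤ size S + size T
size-⊕≤ S T = begin
  size (S ⊕ T)
    ≤⟨ sumF-mono (λ u → sumF-mono (λ v → pointwise (lt u v) (S u v) (T u v))) ⟩
  sumF (λ u → sumF (λ v → edgeCount S u v + edgeCount T u v))
    ≡⟨ size-+ S T ⟩
  size S + size T ∎
  where
  open ≤-Reasoning
  pointwise : ∀ c s t → indicator (c ∧ (s xor t)) ≤ indicator (c ∧ s) + indicator (c ∧ t)
  pointwise false s     t     = z≤n
  pointwise true  true  true  = z≤n
  pointwise true  true  false = ≤-refl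
  pointwise true  false t     = ≤-refl

size-⊕ : ∀ {n} (S T : EdgeSet n) → (∀ u v → S u v ∧ T u v ≡ false) → size (S ⊕ T) ≡ size S + size T
size-⊕ S T disjoint = begin
  size (S ⊕ T)
    ≡⟨ sumF-cong (λ u → sumF-cong (λ v → pointwise (lt u v) (S u v) (T u v) (disjoint u v))) ⟩
  sumF (λ u → sumF (λ v → edgeCount S u v + edgeCount T u v))
    ≡⟨ size-+ S T ⟩
  size S + size T ∎
  where
  open ≡-Reasoning
  pointwise : ∀ c s t → s ∧ t ≡ false → indicator (c ∧ (s xor t)) ≡ indicator (c ∧ s) + indicator (c ∧ t)
  pointwise false s     t     _ = refl
  pointwise true  true  false _ = refl
  pointwise true  false t     _ = refl

size-arrow : ∀ {n} (x y : Fin n) → size (arrow x y) ≡ indicator (lt x y)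
size-arrow x y = begin
  size (arrow x y)                              ≡⟨ sumF-single _ x (λ u u≢x → sumF-zero _ (off-x u≢x)) ⟩
  count (λ v → lt x v ∧ arrow x y x v)          ≡⟨ sumF-single _ y off-y ⟩
  indicator (lt x y ∧ arrow x y x y)            ≡⟨ cong (λ b → indicator (lt x y ∧ b)) (cong₂ _∧_ (=ᶠ-refl x) (=ᶠ-refl y)) ⟩
  indicator (lt x y ∧ true)                     ≡⟨ cong indicator (∧-identityʳ (lt x y)) ⟩
  indicator (lt x y)                            ∎
  where
  open ≡-Reasoning
  off-x : ∀ {u} → u ≢ x → ∀ v → indicator (lt u v ∧ arrow x y u v) ≡ 0
  off-x {u} u≢x v rewrite =ᶠ-≢ u≢x = cong indicator (∧-zeroʳ (lt u v))
  off-y : ∀ v → v ≢ y → indicator (lt x v ∧ arrow x y x v) ≡ 0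
  off-y v v≢y rewrite =ᶠ-≢ v≢y = cong indicator (trans (cong (lt x v ∧_) (∧-zeroʳ (x =ᶠ x))) (∧-zeroʳ (lt x v)))

size-edge : ∀ {n} {x y : Fin n} → x ≢ y → size (edge x y) ≡ 1
size-edge {x = x} {y} x≢y = begin
  size (edge x y)                            ≡⟨ size-⊕ (arrow x y) (arrow y x) disjoint ⟩
  size (arrow x y) + size (arrow y x)        ≡⟨ cong₂ _+_ (size-arrow x y) (size-arrow y x) ⟩
  indicator (lt x y) + indicator (lt y x)    ≡⟨ one (lt-cmp x≢y) ⟩
  1                                          ∎
  where
  open ≡-Reasoning
  disjoint : ∀ u v → arrow x y u v ∧ arrow y x u v ≡ false
  disjoint u v with u Finₚ.≟ x | u Finₚ.≟ y
  ... | yes refl | yes refl = ⊥-elim (x≢y refl)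
  ... | yes refl | no _     = ∧-zeroʳ _
  ... | no _     | _        = refl
  one : (lt x y ≡ true × lt y x ≡ false) ⊎ (lt x y ≡ false × lt y x ≡ true) → indicator (lt x y) + indicator (lt y x) ≡ 1
  one (inj₁ (xy , yx)) rewrite xy | yx = refl
  one (inj₂ (xy , yx)) rewrite xy | yx = refl

size-edge≤1 : ∀ {n} (x y : Fin n) → size (edge x y) ≤ 1
size-edge≤1 {n} x y with x Finₚ.≟ y
... | yes refl = ≤-trans (≤-reflexive (trans (size-cong (λ u v → xor-same (arrow x x u v))) (size-∅ {n}))) z≤n
... | no x≢y   = ≤-reflexive (size-edge x≢y)

size-steps : ∀ {n} (f : ℕ → Fin n) a m → size (steps f a m) ≤ m
size-steps {n} f a zero = ≤-reflexive (size-∅ {n})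
size-steps f a (suc m) = begin
  size (steps f a (suc m))                                  ≤⟨ size-⊕≤ (steps f a m) (edge x y) ⟩
  size (steps f a m) + size (edge x y)                      ≤⟨ +-mono-≤ (size-steps f a m) (size-edge≤1 x y) ⟩
  m + 1                                                     ≡⟨ +-comm m 1 ⟩
  suc m                                                     ∎
  where
  open ≤-Reasoning
  x = f (a + m)
  y = f (suc (a + m))

size-segment : ∀ {n} (f : ℕ → Fin n) a m → size (segment f a (a + m)) ≤ m
size-segment f a m = ≤-trans (≤-reflexive (size-cong (segment-steps f a m))) (size-steps f a m)

size-segment-≡ : ∀ {n} (f : ℕ → Fin n) {a m b} → a + m ≡ b → size (segment f a b) ≤ m
size-segment-≡ f {a} {m} refl = size-segment f a m

size-pos : ∀ {n} (S : EdgeSet n) {u v} → S u v ≡ true → S v u ≡ true → u ≢ v → 1 ≤ size S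
size-pos S {u} {v} Suv Svu u≢v with lt-cmp u≢v
... | inj₁ (u<v , _) = ≤-trans (≤-reflexive (cong indicator (sym (cong₂ _∧_ u<v Suv))))
                         (≤-trans (sumF-point _ v) (sumF-point (λ a → count (λ b → lt a b ∧ S a b)) u))
... | inj₂ (_ , v<u) = ≤-trans (≤-reflexive (cong indicator (sym (cong₂ _∧_ v<u Svu))))
                         (≤-trans (sumF-point _ u) (sumF-point (λ a → count (λ b → lt a b ∧ S a b)) v))

module _ {P : ℕ → Set} (P? : ∀ k → Dec (P k)) where

  find-first : ∀ K → (∃[ d ] (d ≤ K × P d × (∀ j → j < d → ¬ P j))) ⊎ (∀ j → j ≤ K → ¬ P j)
  find-first zero with P? 0
  ... | yes p0 = inj₁ (0 , z≤n , p0 , λ _ ())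
  ... | no ¬p0 = inj₂ λ { zero z≤n → ¬p0 }
  find-first (suc K) with find-first K
  ... | inj₁ (d , d≤K , pd , before) = inj₁ (d , m≤n⇒m≤1+n d≤K , pd , before)
  ... | inj₂ none with P? (suc K)
  ...   | yes pK = inj₁ (suc K , ≤-refl , pK , λ j j≤K → none j (s≤s⁻¹ j≤K))
  ...   | no ¬pK = inj₂ λ j j≤1+K → [ (λ j<1+K → none j (s≤s⁻¹ j<1+K)) , (λ { refl → ¬pK }) ]′ (m≤n⇒m<n∨m≡n j≤1+K)

  least : ∀ {K} → P K → ∃[ d ] (d ≤ K × P d × (∀ j → j < d → ¬ P j))
  least {K} pK = [ id , (λ none → ⊥-elim (none K ≤-refl pK)) ]′ (find-first K)

-- Periodic injective walks

-- In reflect below, p = L ∸ 1 acts as −1 modulo L = suc p = 3 + k: the identities say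
-- p a + (a + b) ≡ b and s + p (s + p + p t) + p ≡ t modulo L.
reflection-identity : ∀ p a b → p * a + (a + b) ≡ b + a * suc p
reflection-identity = solve 3 (λ p a b → p :* a :+ (a :+ b) := b :+ a :* (con 1 :+ p)) refl
  where open +-*-Solver

reflection-inverse : ∀ k s t → let p = 2 + k in s + p * (s + p + p * t) + p ≡ t + (s + p + (1 + k) * t) * (3 + k)
reflection-inverse = solve 3 (λ k s t → s :+ (con 2 :+ k) :* (s :+ (con 2 :+ k) :+ (con 2 :+ k) :* t) :+ (con 2 :+ k)
                                        := t :+ (s :+ (con 2 :+ k) :+ (con 1 :+ k) :* t) :* (con 3 :+ k)) refl
  where open +-*-Solver

module PeriodicWalk {n} {L : ℕ} {w : ℕ → Fin n} (3≤L : 3 ≤ L)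
                    (periodic : ∀ t → w (t + L) ≡ w t)
                    (injective : ∀ t t' → t < L → t' < L → w t ≡ w t' → t ≡ t') where

  instance
    L-nonZero : NonZero L
    L-nonZero = >-nonZero (≤-trans (s≤s z≤n) 3≤L)

  w-+-multiple : ∀ t j → w (t + j * L) ≡ w t
  w-+-multiple t zero    = cong w (+-identityʳ t)
  w-+-multiple t (suc j) = begin
    w (t + (L + j * L))  ≡⟨ cong w (trans (cong (t +_) (+-comm L (j * L))) (sym (+-assoc t (j * L) L))) ⟩
    w (t + j * L + L)    ≡⟨ periodic (t + j * L) ⟩
    w (t + j * L)        ≡⟨ w-+-multiple t j ⟩
    w t                  ∎
    where open ≡-Reasoning

  w-% : ∀ t → w t ≡ w (t % L)
  w-% t = trans (cong w (m≡m%n+[m/n]*n t L)) (w-+-multiple (t % L) (t / L))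

  w-≡⇒multiple : ∀ {a b} → w a ≡ w b → a ≤ b → ∃[ j ] b ≡ a + j * L
  w-≡⇒multiple {a} {b} wa≡wb a≤b = b / L ∸ a / L , (begin
    b                                         ≡⟨ m≡m%n+[m/n]*n b L ⟩
    b % L + b / L * L                         ≡⟨ cong (λ r → r + b / L * L) (sym same-residue) ⟩
    a % L + b / L * L                         ≡⟨ cong (λ q → a % L + q * L) (sym (m+[n∸m]≡n (/-monoˡ-≤ L a≤b))) ⟩
    a % L + (a / L + (b / L ∸ a / L)) * L     ≡⟨ cong (a % L +_) (*-distribʳ-+ L (a / L) _) ⟩
    a % L + (a / L * L + (b / L ∸ a / L) * L) ≡⟨ +-assoc (a % L) _ _ ⟨
    a % L + a / L * L + (b / L ∸ a / L) * L   ≡⟨ cong (_+ (b / L ∸ a / L) * L) (m≡m%n+[m/n]*n a L) ⟨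
    a + (b / L ∸ a / L) * L                   ∎)
    where
    open ≡-Reasoning
    same-residue : a % L ≡ b % L
    same-residue = injective (a % L) (b % L) (m%n<n a L) (m%n<n b L) (trans (sym (w-% a)) (trans wa≡wb (w-% b)))

  w-+-multiple-+ : ∀ a j δ → w (a + j * L + δ) ≡ w (a + δ)
  w-+-multiple-+ a j δ = trans (cong w (+-right-comm a (j * L) δ)) (w-+-multiple (a + δ) j)

  w-shift : ∀ {a b} δ → w a ≡ w b → w (a + δ) ≡ w (b + δ)
  w-shift {a} {b} δ wa≡wb with ≤-total a b
  ... | inj₁ a≤b with w-≡⇒multiple wa≡wb a≤b
  ...   | j , refl = sym (w-+-multiple-+ a j δ)
  w-shift {a} {b} δ wa≡wb | inj₂ b≤a with w-≡⇒multiple (sym wa≡wb) b≤a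
  ...   | j , refl = w-+-multiple-+ b j δ

  w-unshift : ∀ {a b} δ → w (a + δ) ≡ w (b + δ) → w a ≡ w b
  w-unshift {a} {b} δ eq with ≤-total a b
  ... | inj₁ a≤b with w-≡⇒multiple eq (+-monoˡ-≤ δ a≤b)
  ...   | j , b+δ≡ = sym (trans (cong w (+-cancelʳ-≡ δ b (a + j * L) (trans b+δ≡ (+-right-comm a δ (j * L)))))
                                  (w-+-multiple a j))
  w-unshift {a} {b} δ eq | inj₂ b≤a with w-≡⇒multiple (sym eq) (+-monoˡ-≤ δ b≤a)
  ...   | j , a+δ≡ = trans (cong w (+-cancelʳ-≡ δ a (b + j * L) (trans a+δ≡ (+-right-comm b δ (j * L)))))
                           (w-+-multiple b j)

  w-suc : ∀ {a b} → w a ≡ w b → w (suc a) ≡ w (suc b)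
  w-suc {a} {b} wa≡wb = trans (cong w (+-comm 1 a)) (trans (w-shift 1 wa≡wb) (cong w (+-comm b 1)))

  Step-% : ∀ t {u v} → Step w t u v → Step w (t % L) u v
  Step-% t = Step-transport w w (w-% t) (w-suc (w-% t))

  adjacent-distinct : ∀ t → w t ≢ w (suc t)
  adjacent-distinct t eq with injective 0 1 (≤-trans (s≤s z≤n) 3≤L) (≤-trans (s≤s (s≤s z≤n)) 3≤L) (w-unshift {0} {1} t eq)
  ... | ()

  steps-distinct : ∀ {t t'} → t < t' → t' < L → ∀ {u v} → Step w t u v → Step w t' u v → ⊥
  steps-distinct {t} {t'} t<t' t'<L = distinct
    where
    t<L = <-trans t<t' t'<L
    reversed : w t ≡ w (suc t') → w (suc t) ≡ w t' → ⊥
    reversed wt≡ wt'≡ with m≤n⇒m<n∨m≡n t'<L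
    ... | inj₁ 1+t'<L = <-irrefl (injective t (suc t') t<L 1+t'<L wt≡) (m<n⇒m<1+n t<t')
    ... | inj₂ 1+t'≡L = ≤⇒≯ 3≤L (subst (_< 3) (trans (cong suc 1≡t') 1+t'≡L) ≤-refl)
      where
      t≡0 : t ≡ 0
      t≡0 = injective t 0 t<L (≤-trans (s≤s z≤n) 3≤L) (trans wt≡ (trans (cong w 1+t'≡L) (periodic 0)))
      1≡t' : 1 ≡ t'
      1≡t' = injective 1 t' (≤-trans (s≤s (s≤s z≤n)) 3≤L) t'<L (trans (cong (w ∘ suc) (sym t≡0)) wt'≡)
    distinct : ∀ {u v} → Step w t u v → Step w t' u v → ⊥
    distinct (inj₁ (p , q)) (inj₁ (p' , _)) = <-irrefl (injective t t' t<L t'<L (trans p (sym p'))) t<t'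
    distinct (inj₁ (p , q)) (inj₂ (p' , q')) = reversed (trans p (sym q')) (trans q (sym p'))
    distinct (inj₂ (p , q)) (inj₁ (p' , q')) = reversed (trans p (sym q')) (trans q (sym p'))
    distinct (inj₂ (p , q)) (inj₂ (p' , _)) = <-irrefl (injective t t' t<L t'<L (trans p (sym p'))) t<t'

  prefix-excludes-next : ∀ {m} → m < L → ∀ {u v} → Step w m u v → prefix w m u v ≡ false
  prefix-excludes-next {m} m<L {u} {v} step with prefix w m u v in eq
  ... | false = refl
  ... | true  = let (t , t<m , step') = steps⇒Step w 0 m eq in ⊥-elim (steps-distinct t<m m<L step' step)

  Step⇒prefix : ∀ {m t} → m ≤ L → t < m → ∀ {u v} → Step w t u v → prefix w m u v ≡ true
  Step⇒prefix {suc m} {t} 1+m≤L t<1+m {u} {v} step with m≤n⇒m<n∨m≡n (s≤s⁻¹ t<1+m)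
  ... | inj₂ refl = cong₂ _xor_ (prefix-excludes-next 1+m≤L step) (Step⇒edge w t (adjacent-distinct t) step)
  ... | inj₁ t<m with edge (w m) (w (suc m)) u v in eq
  ...   | false = trans (xor-identityʳ _) (Step⇒prefix (<⇒≤ 1+m≤L) t<m step)
  ...   | true  = ⊥-elim (steps-distinct t<m 1+m≤L step (edge⇒Step w m eq))

  prefix-size : ∀ {m} → m ≤ L → size (prefix w m) ≡ m
  prefix-size {zero}  _ = size-∅ {n}
  prefix-size {suc m} 1+m≤L = begin
    size (prefix w m ⊕ edge (w m) (w (suc m)))             ≡⟨ size-⊕ (prefix w m) _ disjoint ⟩
    size (prefix w m) + size (edge (w m) (w (suc m)))      ≡⟨ cong₂ _+_ (prefix-size (<⇒≤ 1+m≤L)) (size-edge (adjacent-distinct m)) ⟩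
    m + 1                                                  ≡⟨ +-comm m 1 ⟩
    suc m                                                  ∎
    where
    open ≡-Reasoning
    disjoint : ∀ u v → prefix w m u v ∧ edge (w m) (w (suc m)) u v ≡ false
    disjoint u v with edge (w m) (w (suc m)) u v in eq
    ... | false = ∧-zeroʳ _
    ... | true  = cong (_∧ true) (prefix-excludes-next 1+m≤L (edge⇒Step w m eq))

  segment-period : ∀ a → segment w a (a + L) ≐ prefix w L
  segment-period a u v = begin
    prefix w a u v xor prefix w (a + L) u v                     ≡⟨ cong (λ m → prefix w a u v xor prefix w m u v) (+-comm a L) ⟩
    prefix w a u v xor prefix w (L + a) u v                     ≡⟨ cong (prefix w a u v xor_) (steps-+ w 0 L a u v) ⟩
    prefix w a u v xor (prefix w L u v xor steps w L a u v)     ≡⟨ cong (λ s → prefix w a u v xor (prefix w L u v xor s)) rotated ⟩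
    prefix w a u v xor (prefix w L u v xor prefix w a u v)      ≡⟨ cong (prefix w a u v xor_) (xor-comm (prefix w L u v) _) ⟩
    prefix w a u v xor (prefix w a u v xor prefix w L u v)      ≡⟨ xor-cancelˡ (prefix w a u v) (prefix w L u v) ⟩
    prefix w L u v                                              ∎
    where
    open ≡-Reasoning
    rotated : steps w L a u v ≡ prefix w a u v
    rotated = steps-cong w w L 0 a (λ t _ → trans (cong w (+-comm L t)) (periodic t)) u v

  segment-multiple : ∀ a j → (segment w a (a + j * L) ≐ ∅) ⊎ (segment w a (a + j * L) ≐ prefix w L)
  segment-multiple a zero    = inj₁ (λ u v → trans (cong (λ m → segment w a m u v) (+-identityʳ a)) (segment-self w a u v))
  segment-multiple a (suc j) =
    [ (λ none → inj₂ (λ u v → trans (split u v) (cong (_xor prefix w L u v) (none u v))))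
    , (λ all → inj₁ (λ u v → trans (split u v) (trans (cong (_xor prefix w L u v) (all u v)) (xor-same (prefix w L u v)))))
    ]′ (segment-multiple a j)
    where
    split : segment w a (a + suc j * L) ≐ segment w a (a + j * L) ⊕ prefix w L
    split u v = begin
      segment w a (a + suc j * L) u v
        ≡⟨ cong (λ m → segment w a m u v) (trans (cong (a +_) (+-comm L (j * L))) (sym (+-assoc a (j * L) L))) ⟩
      segment w a (a + j * L + L) u v
        ≡⟨ segment-trans w a (a + j * L) (a + j * L + L) u v ⟨
      segment w a (a + j * L) u v xor segment w (a + j * L) (a + j * L + L) u v
        ≡⟨ cong (segment w a (a + j * L) u v xor_) (segment-period (a + j * L) u v) ⟩
      segment w a (a + j * L) u v xor prefix w L u v ∎
      where open ≡-Reasoning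

  segment-of-lifts : ∀ {a b} → w a ≡ w b → (segment w a b ≐ ∅) ⊎ (segment w a b ≐ prefix w L)
  segment-of-lifts {a} {b} wa≡wb with ≤-total a b
  ... | inj₁ a≤b with w-≡⇒multiple wa≡wb a≤b
  ...   | j , refl = segment-multiple a j
  segment-of-lifts {a} {b} wa≡wb | inj₂ b≤a with w-≡⇒multiple (sym wa≡wb) b≤a
  ...   | j , refl = [ (λ none → inj₁ (≐-trans (segment-comm w (b + j * L) b) none))
                     , (λ all → inj₂ (≐-trans (segment-comm w (b + j * L) b) all)) ]′ (segment-multiple b j)

  lift-into-window : ∀ Φ q → ∃[ r ] (r < L × w (Φ + r) ≡ w q)
  lift-into-window Φ q = X % L , m%n<n X L , (begin
    w (Φ + X % L)   ≡⟨ cong w (+-comm Φ (X % L)) ⟩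
    w (X % L + Φ)   ≡⟨ w-shift Φ (sym (w-% X)) ⟩
    w (X + Φ)       ≡⟨ cong w X+Φ≡ ⟩
    w (q + Φ * L)   ≡⟨ w-+-multiple q Φ ⟩
    w q             ∎)
    where
    open ≡-Reasoning
    X = q + pred L * Φ
    X+Φ≡ : X + Φ ≡ q + Φ * L
    X+Φ≡ = trans (+-assoc q (pred L * Φ) Φ)
             (cong (q +_) (trans (+-comm (pred L * Φ) Φ) (trans (cong (_* Φ) (suc-pred L)) (*-comm L Φ))))

  w-reverse : ∀ {Φ τ} → τ ≤ Φ → w (Φ + pred L * τ) ≡ w (Φ ∸ τ)
  w-reverse {Φ} {τ} τ≤Φ = trans (cong w (begin
    Φ + pred L * τ              ≡⟨ cong (_+ pred L * τ) (m∸n+n≡m τ≤Φ) ⟨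
    Φ ∸ τ + τ + pred L * τ      ≡⟨ +-assoc (Φ ∸ τ) τ _ ⟩
    Φ ∸ τ + suc (pred L) * τ    ≡⟨ cong (λ l → Φ ∸ τ + l * τ) (suc-pred L) ⟩
    Φ ∸ τ + L * τ               ≡⟨ cong (Φ ∸ τ +_) (*-comm L τ) ⟩
    Φ ∸ τ + τ * L               ∎)) (w-+-multiple (Φ ∸ τ) τ)
    where open ≡-Reasoning

module Circulation {n} {C : EdgeSet n} {L : ℕ} {w : ℕ → Fin n} (circ : IsCirculation C L w) where

  3≤L : 3 ≤ L
  3≤L = proj₁ circ

  periodic : ∀ t → w (t + L) ≡ w t
  periodic = proj₁ (proj₂ circ)

  injective : ∀ t t' → t < L → t' < L → w t ≡ w t' → t ≡ t'
  injective = proj₁ (proj₂ (proj₂ circ))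

  open PeriodicWalk 3≤L periodic injective public

  C⇒Step : ∀ {u v} → C u v ≡ true → ∃[ t ] (t < L × Step w t u v)
  C⇒Step {u} {v} = proj₁ (proj₂ (proj₂ (proj₂ circ)) u v)

  Step⇒C : ∀ t {u v} → Step w t u v → C u v ≡ true
  Step⇒C t {u} {v} step = proj₂ (proj₂ (proj₂ (proj₂ circ)) u v) (t % L , m%n<n t L , Step-% t step)

  step-in-C : ∀ t → C (w t) (w (suc t)) ≡ true
  step-in-C t = Step⇒C t (inj₁ (refl , refl))

  C≐prefix : C ≐ prefix w L
  C≐prefix u v = ≡true⇔⇒≡ (λ c → let (t , t<L , step) = C⇒Step c in Step⇒prefix ≤-refl t<L step)
                            (λ p → let (t , _ , step) = steps⇒Step w 0 L p in Step⇒C t step)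

  size-C : size C ≡ L
  size-C = trans (size-cong C≐prefix) (prefix-size ≤-refl)

  w-on-C : ∀ t → OnCycle C (w t)
  w-on-C t = w (suc t) , step-in-C t

  on-C⇒position : ∀ {v} → OnCycle C v → ∃[ q ] w q ≡ v
  on-C⇒position (u , c) with C⇒Step c
  ... | t , _ , inj₁ (wt≡v , _)  = t , wt≡v
  ... | t , _ , inj₂ (_ , wt'≡v) = suc t , wt'≡v

  segment-turn : ∀ a → segment w a (a + L) ≐ C
  segment-turn a = ≐-trans (segment-period a) (≐-sym C≐prefix)

  segment⇒C : ∀ a b {u v} → segment w a b u v ≡ true → C u v ≡ true
  segment⇒C a b seg = let (t , step) = segment⇒Step w a b seg in Step⇒C t step

  segment-of-lifts-C : ∀ {a b} → w a ≡ w b → (segment w a b ≐ ∅) ⊎ (segment w a b ≐ C)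
  segment-of-lifts-C wa≡wb = [ inj₁ , (λ all → inj₂ (≐-trans all (≐-sym C≐prefix))) ]′ (segment-of-lifts wa≡wb)

  rotate : ∀ s → IsCirculation C L (λ t → w (s + t))
  rotate s = 3≤L , periodic′ , injective′ , λ u v → forward , backward
    where
    periodic′ : ∀ t → w (s + (t + L)) ≡ w (s + t)
    periodic′ t = trans (cong w (sym (+-assoc s t L))) (periodic (s + t))
    injective′ : ∀ t t' → t < L → t' < L → w (s + t) ≡ w (s + t') → t ≡ t'
    injective′ t t' t<L t'<L eq =
      injective t t' t<L t'<L (w-unshift s (trans (cong w (+-comm t s)) (trans eq (cong w (+-comm s t')))))
    forward : ∀ {u v} → C u v ≡ true → ∃[ t ] (t < L × Step (λ t → w (s + t)) t u v)
    forward c with C⇒Step c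
    ... | T , _ , step with lift-into-window s T
    ...   | r , r<L , w[s+r]≡wT =
      r , r<L , Step-transport w (λ t → w (s + t)) (sym w[s+r]≡wT) (sym (trans (cong w (+-suc s r)) (w-suc w[s+r]≡wT))) step
    backward : ∀ {u v} → ∃[ t ] (t < L × Step (λ t → w (s + t)) t u v) → C u v ≡ true
    backward (t , _ , step) = Step⇒C (s + t) (Step-transport (λ t → w (s + t)) w refl (cong w (+-suc s t)) step)

  reflect : ∀ s → IsCirculation C L (λ t → w (s + pred L * t))
  reflect s = 3≤L , periodic′ , injective′ , λ u v → forward , backward
    where
    p = pred L
    w′ : ℕ → Fin n
    w′ t = w (s + p * t)

    -- the t-th step of w′ is the (s + p t + p)-th step of w, traversed backwards
    Z : ℕ → ℕ
    Z t = s + p * t + p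

    w′-suc : ∀ t → w′ (suc t) ≡ w (Z t)
    w′-suc t = cong w (trans (cong (s +_) (trans (*-suc p t) (+-comm p (p * t)))) (sym (+-assoc s (p * t) p)))

    w′-now : ∀ t → w′ t ≡ w (suc (Z t))
    w′-now t = sym (trans (cong w (trans (sym (+-suc (s + p * t) p)) (cong (s + p * t +_) (suc-pred L))))
                          (periodic (s + p * t)))

    periodic′ : ∀ t → w′ (t + L) ≡ w′ t
    periodic′ t = trans (cong w (trans (cong (s +_) (*-distribˡ-+ p t L)) (sym (+-assoc s (p * t) (p * L)))))
                        (w-+-multiple (s + p * t) p)

    injective′ : ∀ t t' → t < L → t' < L → w′ t ≡ w′ t' → t ≡ t'
    injective′ t t' t<L t'<L eq = sym (injective t' t t'<L t<L (begin
      w t'                       ≡⟨ w-+-multiple t' t ⟨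
      w (t' + t * L)             ≡⟨ cong (λ l → w (t' + t * l)) (suc-pred L) ⟨
      w (t' + t * suc p)         ≡⟨ cong w (reflection-identity p t t') ⟨
      w (p * t + (t + t'))       ≡⟨ w-shift (t + t') (w-unshift s (trans (cong w (+-comm (p * t) s)) (trans eq (cong w (+-comm s (p * t')))))) ⟩
      w (p * t' + (t + t'))      ≡⟨ cong (λ x → w (p * t' + x)) (+-comm t t') ⟩
      w (p * t' + (t' + t))      ≡⟨ cong w (reflection-identity p t' t) ⟩
      w (t + t' * suc p)         ≡⟨ cong (λ l → w (t + t' * l)) (suc-pred L) ⟩
      w (t + t' * L)             ≡⟨ w-+-multiple t t' ⟩
      w t                        ∎))
      where open ≡-Reasoning

    module W′ = PeriodicWalk 3≤L periodic′ injective′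

    backward : ∀ {u v} → ∃[ t ] (t < L × Step w′ t u v) → C u v ≡ true
    backward (t , _ , step) = Step⇒C (Z t) (Step-transport-reversed w′ w (w′-now t) (w′-suc t) step)

    forward : ∀ {u v} → C u v ≡ true → ∃[ t ] (t < L × Step w′ t u v)
    forward c with C⇒Step c | m≤n⇒∃[o]m+o≡n 3≤L
    ... | T , _ , step | k , refl = t₀ % L , m%n<n t₀ L ,
      Step-transport-reversed w w′ (trans (sym Zt₀≈T) (trans (sym (w′-suc t₀)) (W′.w-suc (W′.w-% t₀))))
                                   (trans (w-suc (sym Zt₀≈T)) (trans (sym (w′-now t₀)) (W′.w-% t₀))) step
      where
      t₀ = s + p + p * T
      Zt₀≈T : w (Z t₀) ≡ w T
      Zt₀≈T = trans (cong w (reflection-inverse k s T)) (w-+-multiple T (s + p + suc k * T))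

-- The cycle space and its bases

module CycleSpace (G : Graph) where

  mkCycle : ∀ {D} → (∀ u v → D u v ≡ D v u) → (∀ u v → D u v ≡ true → adj G u v ≡ true) →
            (∀ v → xorF (D v) ≡ false) → IsCycle G D
  mkCycle {D} symmetric in-G parity = (symmetric , in-G) , λ v → xorF-false⇒even (D v) (parity v)

  cycle-sym : ∀ {D} → IsCycle G D → ∀ u v → D u v ≡ D v u
  cycle-sym cyc = proj₁ (proj₁ cyc)

  cycle-adj : ∀ {D} → IsCycle G D → ∀ {u v} → D u v ≡ true → adj G u v ≡ true
  cycle-adj cyc {u} {v} = proj₂ (proj₁ cyc) u v

  cycle-parity : ∀ {D} → IsCycle G D → ∀ v → xorF (D v) ≡ false
  cycle-parity {D} cyc v = even⇒xorF-false (D v) (proj₂ cyc v)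

  cycle-loopless : ∀ {D} → IsCycle G D → ∀ {u v} → D u v ≡ true → u ≢ v
  cycle-loopless cyc Duv refl with trans (sym (irrefl G _)) (cycle-adj cyc Duv)
  ... | ()

  cycle-⊕ : ∀ {S T} → IsCycle G S → IsCycle G T → IsCycle G (S ⊕ T)
  cycle-⊕ {S} {T} cS cT = mkCycle
    (λ u v → cong₂ _xor_ (cycle-sym cS u v) (cycle-sym cT u v))
    (λ u v ST → [ cycle-adj cS , cycle-adj cT ]′ (xor-true (S u v) (T u v) ST))
    (λ v → trans (xorF-xor (S v) (T v)) (cong₂ _xor_ (cycle-parity cS v) (cycle-parity cT v)))

module Basis (G : Graph) {m} (B : Fin m → EdgeSet (n G)) (basis : IsBasis G B) where

  Represents : (Fin m → Bool) → EdgeSet (n G) → Set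
  Represents c D = ∀ u v → comb c B u v ≡ D u v

  comb-cong : ∀ {c d} → (∀ i → c i ≡ d i) → ∀ u v → comb c B u v ≡ comb d B u v
  comb-cong c≗d u v = xorF-cong (λ i → cong (_∧ B i u v) (c≗d i))

  comb-xor : ∀ c d u v → comb (λ i → c i xor d i) B u v ≡ comb c B u v xor comb d B u v
  comb-xor c d u v = trans (xorF-cong (λ i → ∧-distribʳ-xor (B i u v) (c i) (d i)))
                           (xorF-xor (λ i → c i ∧ B i u v) (λ i → d i ∧ B i u v))

  comb-∧ : ∀ b c u v → comb (λ i → b ∧ c i) B u v ≡ b ∧ comb c B u v
  comb-∧ b c u v = trans (xorF-cong (λ i → ∧-assoc b (c i) (B i u v))) (xorF-∧ b (λ i → c i ∧ B i u v))

  represents-⊕ : ∀ {c d S T} → Represents c S → Represents d T → Represents (λ i → c i xor d i) (S ⊕ T)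
  represents-⊕ {c} {d} rS rT u v = trans (comb-xor c d u v) (cong₂ _xor_ (rS u v) (rT u v))

  represents-∅ : Represents (λ _ → false) ∅
  represents-∅ u v = xorF-false (λ i → false ∧ B i u v) (λ _ → refl)

  represents-element : ∀ z → Represents (_=ᶠ z) (B z)
  represents-element z u v = trans (xorF-single (λ i → (i =ᶠ z) ∧ B i u v) z (λ i i≢z → cong (_∧ B i u v) (=ᶠ-≢ i≢z)))
                                   (cong (_∧ B z u v) (=ᶠ-refl z))

  represents-≐ : ∀ {c S T} → Represents c S → S ≐ T → Represents c T
  represents-≐ rS S≐T u v = trans (rS u v) (S≐T u v)

  represents-unique : ∀ {c d S} → Represents c S → Represents d S → ∀ i → c i ≡ d i
  represents-unique {c} {d} {S} rc rd i = xor-false⇒≡ (c i) (d i)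
    (proj₁ (proj₂ basis) (λ j → c j xor d j) (λ u v → trans (represents-⊕ rc rd u v) (xor-same (S u v))) i)

  represents-exists : ∀ {D} → IsCycle G D → ∃[ c ] Represents c D
  represents-exists cD = proj₂ (proj₂ basis) _ cD

module MinimumBasis (G : Graph) {m} (B : Fin m → EdgeSet (n G)) (mcb : IsMCB G B) where

  open CycleSpace G
  open Basis G B (proj₁ mcb) public

  element-cycle : ∀ z → IsCycle G (B z)
  element-cycle = proj₁ (proj₁ mcb)

  -- Replacing B z by a cycle D whose representation uses B z gives another basis B′: the change of
  -- coordinates e ↦ e ⊕ e_z (d ⊕ 1_z) between B′ and B is an involution.
  exchange : ∀ {D d} → IsCycle G D → Represents d D → ∀ {z} → d z ≡ true → size (B z) ≤ size D
  exchange {D} {d} cD rD {z} dz = +-cancelˡ-≤ (weight B) (size (B z)) (size D)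
    (≤-trans (+-monoˡ-≤ (size (B z)) (proj₂ mcb B′ basis′)) (≤-reflexive weight-exchange))
    where
    B′ : Fin m → EdgeSet (n G)
    B′ = updateAt B z (λ _ → D)

    d′ : Fin m → Bool
    d′ i = d i xor (i =ᶠ z)

    d′z≡false : d′ z ≡ false
    d′z≡false rewrite dz | =ᶠ-refl z = refl

    coords : (Fin m → Bool) → Fin m → Bool
    coords e i = e i xor (e z ∧ d′ i)

    coordsz : ∀ e → coords e z ≡ e z
    coordsz e rewrite d′z≡false | ∧-zeroʳ (e z) = xor-identityʳ (e z)

    coords-involutive : ∀ e i → coords (coords e) i ≡ e i
    coords-involutive e i rewrite coordsz e = xor-cancelʳ (e i) (e z ∧ d′ i)

    entry : ∀ e i u v → e i ∧ B′ i u v ≡ (e i ∧ B i u v) xor ((i =ᶠ z) ∧ (e z ∧ (D u v xor B z u v)))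
    entry e i u v with i Finₚ.≟ z
    ... | yes refl rewrite updateAt-updates i {λ _ → D} B = exchanged (e i) (D u v) (B i u v)
      where
      exchanged : ∀ a x y → a ∧ x ≡ (a ∧ y) xor (a ∧ (x xor y))
      exchanged false x     y     = refl
      exchanged true  x     false = sym (xor-identityʳ x)
      exchanged true  false true  = refl
      exchanged true  true  true  = refl
    ... | no i≢z rewrite updateAt-minimal i z {λ _ → D} B i≢z = sym (xor-identityʳ _)

    comb-B′ : ∀ e u v → comb e B′ u v ≡ comb (coords e) B u v
    comb-B′ e u v = begin
      comb e B′ u v
        ≡⟨ xorF-cong (λ i → entry e i u v) ⟩
      xorF (λ i → (e i ∧ B i u v) xor ((i =ᶠ z) ∧ X))
        ≡⟨ xorF-xor (λ i → e i ∧ B i u v) (λ i → (i =ᶠ z) ∧ X) ⟩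
      comb e B u v xor xorF (λ i → (i =ᶠ z) ∧ X)
        ≡⟨ cong (comb e B u v xor_) (trans (xorF-single _ z (λ i i≢z → cong (_∧ X) (=ᶠ-≢ i≢z))) (cong (_∧ X) (=ᶠ-refl z))) ⟩
      comb e B u v xor X
        ≡⟨ cong (λ Y → comb e B u v xor (e z ∧ Y)) (represents-⊕ rD (represents-element z) u v) ⟨
      comb e B u v xor (e z ∧ comb d′ B u v)
        ≡⟨ cong (comb e B u v xor_) (comb-∧ (e z) d′ u v) ⟨
      comb e B u v xor comb (λ i → e z ∧ d′ i) B u v
        ≡⟨ comb-xor e (λ i → e z ∧ d′ i) u v ⟨
      comb (coords e) B u v ∎
      where
      open ≡-Reasoning
      X = e z ∧ (D u v xor B z u v)

    basis′ : IsBasis G B′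
    basis′ = cycles , independent , spanning
      where
      cycles : ∀ i → IsCycle G (B′ i)
      cycles i with i Finₚ.≟ z
      ... | yes refl = subst (IsCycle G) (sym (updateAt-updates i B)) cD
      ... | no i≢z   = subst (IsCycle G) (sym (updateAt-minimal i z B i≢z)) (element-cycle i)
      independent : ∀ e → (∀ u v → comb e B′ u v ≡ false) → ∀ i → e i ≡ false
      independent e e≐∅ i = begin
        e i                                          ≡⟨ coords-involutive e i ⟨
        coords e i xor (coords e z ∧ d′ i)           ≡⟨ cong₂ (λ a b → a xor (b ∧ d′ i)) (vanish i) (vanish z) ⟩
        false                                        ∎
        where
        open ≡-Reasoning
        vanish : ∀ j → coords e j ≡ false
        vanish = proj₁ (proj₂ (proj₁ mcb)) (coords e) (λ u v → trans (sym (comb-B′ e u v)) (e≐∅ u v))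
      spanning : ∀ C → IsCycle G C → ∃[ e ] (∀ u v → comb e B′ u v ≡ C u v)
      spanning C cC = let (f , rC) = represents-exists cC in
        coords f , λ u v → trans (comb-B′ (coords f) u v) (trans (comb-cong (coords-involutive f) u v) (rC u v))

    weight-exchange : weight B′ + size (B z) ≡ weight B + size D
    weight-exchange = trans (sumF-agree-off z (λ i i≢z → cong size (updateAt-minimal i z B i≢z)))
                            (cong (λ X → weight B + size X) (updateAt-updates z B))

  element-split : ∀ z {S T} → IsCycle G S → IsCycle G T → B z ≐ S ⊕ T → size (B z) ≤ size S ⊎ size (B z) ≤ size T
  element-split z cS cT Bz≐S⊕T with represents-exists cS | represents-exists cT
  ... | c , rS | d , rT
    with xor-true (c z) (d z) (trans (represents-unique (represents-⊕ rS rT) (represents-≐ (represents-element z) Bz≐S⊕T) z)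
                                     (=ᶠ-refl z))
  ...   | inj₁ cz = inj₁ (exchange cS rS cz)
  ...   | inj₂ dz = inj₂ (exchange cT rT dz)

-- Elements of a minimum cycle basis are circuits

HasCirculation : ∀ {n} → EdgeSet n → Set
HasCirculation C = ∃[ L ] ∃[ w ] IsCirculation C L w

module ElementCirculation (G : Graph) {m} (B : Fin m → EdgeSet (n G)) (mcb : IsMCB G B) (z : Fin m) where

  open CycleSpace G
  open MinimumBasis G B mcb

  C : EdgeSet (n G)
  C = B z

  -- The closed walk spans a cycle D ⊆ C; if D ≠ C, then C = D ⊕ (C ⊕ D) with both parts shorter than C.
  closed-walk⇒circulation : ∀ {L w} (3≤L : 3 ≤ L) (periodic : ∀ t → w (t + L) ≡ w t)
                            (injective : ∀ t t' → t < L → t' < L → w t ≡ w t' → t ≡ t') →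
                            (∀ {t} → t < L → C (w t) (w (suc t)) ≡ true) → IsCirculation C L w
  closed-walk⇒circulation {L} {w} 3≤L periodic injective in-C =
    3≤L , periodic , injective , λ u v → C⇒Step , Step⇒C
    where
    open PeriodicWalk 3≤L periodic injective

    D = prefix w L

    Step⇒C : ∀ {u v} → ∃[ t ] (t < L × Step w t u v) → C u v ≡ true
    Step⇒C (t , t<L , inj₁ (refl , refl)) = in-C t<L
    Step⇒C (t , t<L , inj₂ (refl , refl)) = trans (cycle-sym (element-cycle z) _ _) (in-C t<L)

    D⊆C : ∀ {u v} → D u v ≡ true → C u v ≡ true
    D⊆C Duv = Step⇒C (steps⇒Step w 0 L Duv)

    cD : IsCycle G D
    cD = mkCycle (steps-sym w 0 L) (λ u v Duv → cycle-adj (element-cycle z) (D⊆C Duv))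
      (λ v → trans (steps-parity w 0 L v) (trans (cong (λ x → (v =ᶠ w 0) xor (v =ᶠ x)) (periodic 0)) (xor-same (v =ᶠ w 0))))

    C⊆D : ∀ {u v} → C u v ≡ true → D u v ≡ true
    C⊆D {u} {v} Cuv with D u v in Duv
    ... | true  = refl
    ... | false = ⊥-elim (too-short (element-split z cD (cycle-⊕ (element-cycle z) cD) C≐D⊕R))
      where
      R = C ⊕ D
      C≐D⊕R : C ≐ D ⊕ R
      C≐D⊕R a b = sym (trans (cong (D a b xor_) (xor-comm (C a b) (D a b))) (xor-cancelˡ (D a b) (C a b)))
      disjoint : ∀ a b → D a b ∧ R a b ≡ false
      disjoint a b with D a b in Dab
      ... | false = refl
      ... | true  = cong (_xor true) (D⊆C Dab)
      size-C≡ : size C ≡ size D + size R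
      size-C≡ = trans (size-cong C≐D⊕R) (size-⊕ D R disjoint)
      1≤size-R : 1 ≤ size R
      1≤size-R = size-pos R (cong₂ _xor_ Cuv Duv)
                   (trans (cong₂ _xor_ (cycle-sym (element-cycle z) v u) (steps-sym w 0 L v u)) (cong₂ _xor_ Cuv Duv))
                   (cycle-loopless (element-cycle z) Cuv)
      1≤size-D : 1 ≤ size D
      1≤size-D = ≤-trans (≤-trans (s≤s z≤n) 3≤L) (≤-reflexive (sym (prefix-size ≤-refl)))
      too-short : size C ≤ size D ⊎ size C ≤ size R → ⊥
      too-short (inj₁ C≤D) = ≤⇒≯ C≤D (subst (size D <_) (sym size-C≡) (m<m+n (size D) 1≤size-R))
      too-short (inj₂ C≤R) = ≤⇒≯ C≤R (subst (size R <_) (sym size-C≡) (m<n+m (size R) 1≤size-D))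

    C⇒Step : ∀ {u v} → C u v ≡ true → ∃[ t ] (t < L × Step w t u v)
    C⇒Step Cuv = steps⇒Step w 0 L (C⊆D Cuv)

  record SimplePath (t : ℕ) : Set where
    field
      vertex   : ℕ → Fin (n G)
      distinct : ∀ {i j} → i ≤ t → j ≤ t → vertex i ≡ vertex j → i ≡ j
      in-C     : ∀ {i} → i < t → C (vertex i) (vertex (suc i)) ≡ true

  simple-path-bound : ∀ {t} → SimplePath t → t < n G
  simple-path-bound {t} P with suc t ≤? n G
  ... | yes t<n = t<n
  ... | no t≮n with Finₚ.pigeonhole (≰⇒> t≮n) (λ (i : Fin (suc t)) → vertex (toℕ i))
    where open SimplePath P
  ...   | i , j , i<j , same = ⊥-elim (<-irrefl (distinct (s≤s⁻¹ (Finₚ.toℕ<n i)) (s≤s⁻¹ (Finₚ.toℕ<n j)) same) i<j)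
    where open SimplePath P

  close : ∀ {t i} (P : SimplePath t) → i + 2 ≤ t →
          C (SimplePath.vertex P t) (SimplePath.vertex P i) ≡ true → HasCirculation C
  close {t} {i} P i+2≤t closing = L , w , closed-walk⇒circulation 3≤L periodic injective in-C′
    where
    open SimplePath P
    L = suc (t ∸ i)
    w : ℕ → Fin (n G)
    w s = vertex (i + s % L)
    i≤t : i ≤ t
    i≤t = ≤-trans (m≤m+n i 2) i+2≤t
    3≤L : 3 ≤ L
    3≤L = s≤s (subst (_≤ t ∸ i) (m+n∸m≡n i 2) (∸-monoˡ-≤ i i+2≤t))
    periodic : ∀ s → w (s + L) ≡ w s
    periodic s = cong (λ r → vertex (i + r)) ([m+n]%n≡m%n s L)
    in-range : ∀ {s} → s < L → i + s ≤ t
    in-range {s} s<L = subst (i + s ≤_) (m+[n∸m]≡n i≤t) (+-monoʳ-≤ i (s≤s⁻¹ s<L))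
    w-below : ∀ {s} → s < L → w s ≡ vertex (i + s)
    w-below s<L = cong (λ r → vertex (i + r)) (m<n⇒m%n≡m s<L)
    injective : ∀ s s' → s < L → s' < L → w s ≡ w s' → s ≡ s'
    injective s s' s<L s'<L eq =
      +-cancelˡ-≡ i s s' (distinct (in-range s<L) (in-range s'<L) (trans (sym (w-below s<L)) (trans eq (w-below s'<L))))
    in-C′ : ∀ {s} → s < L → C (w s) (w (suc s)) ≡ true
    in-C′ {s} s<L with m≤n⇒m<n∨m≡n s<L
    ... | inj₁ 1+s<L = subst₂ (λ a b → C a b ≡ true) (sym (w-below s<L)) (sym (trans (w-below 1+s<L) (cong vertex (+-suc i s))))
                         (in-C (subst (_≤ t) (+-suc i s) (in-range 1+s<L)))
    ... | inj₂ 1+s≡L = subst₂ (λ a b → C a b ≡ true) (sym w-end) (sym w-wrap) closing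
      where
      w-end : w s ≡ vertex t
      w-end = trans (w-below s<L) (cong vertex (trans (cong (i +_) (suc-injective 1+s≡L)) (m+[n∸m]≡n i≤t)))
      w-wrap : w (suc s) ≡ vertex i
      w-wrap = cong vertex (trans (cong (λ r → i + r % L) 1+s≡L) (trans (cong (i +_) (n%n≡0 L)) (+-identityʳ i)))

  extend : ∀ {t} (P : SimplePath t) {u} → (∀ i → i ≤ t → SimplePath.vertex P i ≢ u) →
           C (SimplePath.vertex P t) u ≡ true → SimplePath (suc t)
  extend {t} P {u} fresh step = record { vertex = vertex′ ; distinct = distinct′ ; in-C = in-C′ }
    where
    open SimplePath P
    vertex′ : ℕ → Fin (n G)
    vertex′ j = if does (j ≤? t) then vertex j else u
    old : ∀ {j} → j ≤ t → vertex′ j ≡ vertex j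
    old {j} j≤t = cong (if_then vertex j else u) (dec-true (j ≤? t) j≤t)
    new : vertex′ (suc t) ≡ u
    new = cong (if_then vertex (suc t) else u) (dec-false (suc t ≤? t) (n≮n t))
    distinct′ : ∀ {i j} → i ≤ suc t → j ≤ suc t → vertex′ i ≡ vertex′ j → i ≡ j
    distinct′ {i} {j} i≤ j≤ eq with m≤n⇒m<n∨m≡n i≤ | m≤n⇒m<n∨m≡n j≤
    ... | inj₁ i<1+t | inj₁ j<1+t =
      distinct (s≤s⁻¹ i<1+t) (s≤s⁻¹ j<1+t) (trans (sym (old (s≤s⁻¹ i<1+t))) (trans eq (old (s≤s⁻¹ j<1+t))))
    ... | inj₁ i<1+t | inj₂ refl  = ⊥-elim (fresh i (s≤s⁻¹ i<1+t) (trans (sym (old (s≤s⁻¹ i<1+t))) (trans eq new)))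
    ... | inj₂ refl  | inj₁ j<1+t = ⊥-elim (fresh j (s≤s⁻¹ j<1+t) (trans (sym (old (s≤s⁻¹ j<1+t))) (trans (sym eq) new)))
    ... | inj₂ refl  | inj₂ refl  = refl
    in-C′ : ∀ {i} → i < suc t → C (vertex′ i) (vertex′ (suc i)) ≡ true
    in-C′ {i} i<1+t with m≤n⇒m<n∨m≡n (s≤s⁻¹ i<1+t)
    ... | inj₁ i<t  = subst₂ (λ a b → C a b ≡ true) (sym (old (<⇒≤ i<t))) (sym (old i<t)) (in-C i<t)
    ... | inj₂ refl = subst₂ (λ a b → C a b ≡ true) (sym (old ≤-refl)) (sym new) step

  -- Each vertex of C has even degree, so the walk can always leave its current vertex along a new edge;
  -- by pigeonhole it eventually returns to an earlier vertex, which closes a circuit.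
  grow : ∀ fuel {t} → n G ≤ suc t + fuel → SimplePath (suc t) → HasCirculation C
  grow zero {t} n≤ P = ⊥-elim (≤⇒≯ (subst (n G ≤_) (+-identityʳ (suc t)) n≤) (simple-path-bound P))
  grow (suc fuel) {t} n≤ P with another-true (C (vertex (suc t))) (cycle-parity (element-cycle z) (vertex (suc t)))
                                             (trans (cycle-sym (element-cycle z) _ _) (in-C ≤-refl))
    where open SimplePath P
  ... | u , u≢prev , step with find-first (λ i → SimplePath.vertex P i Finₚ.≟ u) (suc t)
  ...   | inj₂ fresh = grow fuel (subst (n G ≤_) (+-suc (suc t) fuel) n≤) (extend P fresh step)
  ...   | inj₁ (i , i≤1+t , vi≡u , _) = close P i+2≤ (subst (λ x → C _ x ≡ true) (sym vi≡u) step)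
    where
    open SimplePath P
    i+2≤ : i + 2 ≤ suc t
    i+2≤ with m≤n⇒m<n∨m≡n i≤1+t
    ... | inj₂ refl = ⊥-elim (cycle-loopless (element-cycle z) step vi≡u)
    ... | inj₁ i<1+t with m≤n⇒m<n∨m≡n (s≤s⁻¹ i<1+t)
    ...   | inj₂ refl = ⊥-elim (u≢prev (sym vi≡u))
    ...   | inj₁ i<t  = subst (_≤ suc t) (+-comm 2 i) (s≤s i<t)

  circulation : ∀ {v} → OnCycle C v → HasCirculation C
  circulation {v} (u , Cvu) = grow (n G) (m≤n+m (n G) 1) start
    where
    start-vertex : ℕ → Fin (n G)
    start-vertex zero    = v
    start-vertex (suc _) = u
    start : SimplePath 1
    start = record { vertex = start-vertex ; distinct = distinct ; in-C = λ { {zero} _ → Cvu ; {suc _} (s≤s ()) } }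
      where
      distinct : ∀ {i j} → i ≤ 1 → j ≤ 1 → start-vertex i ≡ start-vertex j → i ≡ j
      distinct {zero}       {zero}       _         _         _   = refl
      distinct {zero}       {suc zero}   _         _         v≡u = ⊥-elim (cycle-loopless (element-cycle z) Cvu v≡u)
      distinct {suc zero}   {zero}       _         _         u≡v = ⊥-elim (cycle-loopless (element-cycle z) Cvu (sym u≡v))
      distinct {suc zero}   {suc zero}   _         _         _   = refl
      distinct {suc (suc _)}             (s≤s ())
      distinct {_}          {suc (suc _)} _        (s≤s ())

-- Decomposing the marked positions of an interval into maximal runs

update : (ℕ → ℕ) → ℕ → ℕ → ℕ → ℕ
update f j x i = if does (i ≟ j) then x else f i

update-same : ∀ f j x → update f j x j ≡ x
update-same f j x = cong (if_then x else f j) (dec-true (j ≟ j) refl)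

update-other : ∀ f j x {i} → i ≢ j → update f j x i ≡ f i
update-other f j x {i} i≢j = cong (if_then x else f i) (dec-false (i ≟ j) i≢j)

sumTo-cong : ∀ k {f g : ℕ → ℕ} → (∀ i → i < k → f i ≡ g i) → sumTo k f ≡ sumTo k g
sumTo-cong zero    f≗g = refl
sumTo-cong (suc k) f≗g = cong₂ _+_ (sumTo-cong k (λ i i<k → f≗g i (m<n⇒m<1+n i<k))) (f≗g k ≤-refl)

sumTo-mono : ∀ (f : ℕ → ℕ) {i j} → i ≤ j → sumTo i f ≤ sumTo j f
sumTo-mono f {i} {j} i≤j with m≤n⇒m<n∨m≡n i≤j
... | inj₂ refl = ≤-refl
sumTo-mono f {i} {suc j} i≤j | inj₁ i<1+j = ≤-trans (sumTo-mono f (s≤s⁻¹ i<1+j)) (m≤m+n (sumTo j f) (f j))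

-- Run i occupies positions start i, …, start i + ℓ i and is followed by a gap of g i steps.
start : (ℕ → ℕ) → (ℕ → ℕ) → ℕ → ℕ
start ℓ g i = sumTo i (λ j → ℓ j + g j)

module Runs {Marked MarkedStep : ℕ → Set} (marked? : ∀ t → Dec (Marked t)) (markedStep? : ∀ t → Dec (MarkedStep t))
            (step-ends-marked : ∀ {t} → MarkedStep t → Marked t × Marked (suc t)) (marked-0 : Marked 0) where

  record RunsTo (N : ℕ) : Set where
    field
      k               : ℕ
      ℓ g             : ℕ → ℕ
      ends            : start ℓ g k + ℓ k ≡ N
      gap-positive    : ∀ {i} → i < k → 1 ≤ g i
      run-marked      : ∀ {i t} → i ≤ k → t ≤ ℓ i → Marked (start ℓ g i + t)
      run-step-marked : ∀ {i t} → i ≤ k → t < ℓ i → MarkedStep (start ℓ g i + t)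
      marked-in-run   : ∀ {τ} → τ ≤ N → Marked τ → ∃[ i ] ∃[ t ] (i ≤ k × t ≤ ℓ i × start ℓ g i + t ≡ τ)
      step-in-run     : ∀ {τ} → τ < N → MarkedStep τ → ∃[ i ] ∃[ t ] (i ≤ k × t < ℓ i × start ℓ g i + t ≡ τ)

  initial : RunsTo 0
  initial = record
    { k = 0 ; ℓ = λ _ → 0 ; g = λ _ → 0 ; ends = refl ; gap-positive = λ ()
    ; run-marked = λ { {zero} {zero} _ _ → marked-0 } ; run-step-marked = λ { {zero} _ () }
    ; marked-in-run = λ { {zero} _ _ → 0 , 0 , z≤n , z≤n , refl } ; step-in-run = λ () }

  extend-run : ∀ {N} → RunsTo N → Marked (suc N) → MarkedStep N → RunsTo (suc N)
  extend-run {N} R mN sN = record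
    { k = k ; ℓ = ℓ′ ; g = g ; ends = ends′ ; gap-positive = gap-positive
    ; run-marked = run-marked′ ; run-step-marked = run-step-marked′ ; marked-in-run = marked-in-run′ ; step-in-run = step-in-run′ }
    where
    open RunsTo R
    ℓ′ = update ℓ k (suc (ℓ k))
    same-start : ∀ {i} → i ≤ k → start ℓ′ g i ≡ start ℓ g i
    same-start i≤k = sumTo-cong _ (λ j j<i → cong (_+ g j) (update-other ℓ k _ (<⇒≢ (<-≤-trans j<i i≤k))))
    ℓ≤ℓ′ : ∀ i → ℓ i ≤ ℓ′ i
    ℓ≤ℓ′ i with i ≟ k
    ... | yes refl = ≤-trans (n≤1+n (ℓ i)) (≤-reflexive (sym (update-same ℓ i _)))
    ... | no i≢k   = ≤-reflexive (sym (update-other ℓ k _ i≢k))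
    ends′ : start ℓ′ g k + ℓ′ k ≡ suc N
    ends′ = trans (cong₂ _+_ (same-start ≤-refl) (update-same ℓ k _)) (trans (+-suc _ _) (cong suc ends))
    run-marked′ : ∀ {i t} → i ≤ k → t ≤ ℓ′ i → Marked (start ℓ′ g i + t)
    run-marked′ {i} {t} i≤k t≤ rewrite same-start i≤k with i ≟ k
    ... | no i≢k = run-marked i≤k (subst (t ≤_) (update-other ℓ k _ i≢k) t≤)
    ... | yes refl with m≤n⇒m<n∨m≡n (subst (t ≤_) (update-same ℓ k _) t≤)
    ...   | inj₁ t<1+ℓ = run-marked ≤-refl (s≤s⁻¹ t<1+ℓ)
    ...   | inj₂ refl  = subst Marked (sym (trans (+-suc _ _) (cong suc ends))) mN
    run-step-marked′ : ∀ {i t} → i ≤ k → t < ℓ′ i → MarkedStep (start ℓ′ g i + t)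
    run-step-marked′ {i} {t} i≤k t< rewrite same-start i≤k with i ≟ k
    ... | no i≢k = run-step-marked i≤k (subst (t <_) (update-other ℓ k _ i≢k) t<)
    ... | yes refl with m≤n⇒m<n∨m≡n (s≤s⁻¹ (subst (t <_) (update-same ℓ k _) t<))
    ...   | inj₁ t<ℓ  = run-step-marked ≤-refl t<ℓ
    ...   | inj₂ refl = subst MarkedStep (sym ends) sN
    marked-in-run′ : ∀ {τ} → τ ≤ suc N → Marked τ → ∃[ i ] ∃[ t ] (i ≤ k × t ≤ ℓ′ i × start ℓ′ g i + t ≡ τ)
    marked-in-run′ τ≤ mτ with m≤n⇒m<n∨m≡n τ≤
    ... | inj₂ refl = k , suc (ℓ k) , ≤-refl , ≤-reflexive (sym (update-same ℓ k _)) ,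
                      trans (cong (_+ suc (ℓ k)) (same-start ≤-refl)) (trans (+-suc _ _) (cong suc ends))
    ... | inj₁ τ<1+N = let (i , t , i≤k , t≤ , eq) = marked-in-run (s≤s⁻¹ τ<1+N) mτ in
                       i , t , i≤k , ≤-trans t≤ (ℓ≤ℓ′ i) , trans (cong (_+ t) (same-start i≤k)) eq
    step-in-run′ : ∀ {τ} → τ < suc N → MarkedStep τ → ∃[ i ] ∃[ t ] (i ≤ k × t < ℓ′ i × start ℓ′ g i + t ≡ τ)
    step-in-run′ τ< sτ with m≤n⇒m<n∨m≡n (s≤s⁻¹ τ<)
    ... | inj₂ refl = k , ℓ k , ≤-refl , ≤-reflexive (sym (update-same ℓ k _)) , trans (cong (_+ ℓ k) (same-start ≤-refl)) ends
    ... | inj₁ τ<N  = let (i , t , i≤k , t< , eq) = step-in-run τ<N sτ in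
                      i , t , i≤k , <-≤-trans t< (ℓ≤ℓ′ i) , trans (cong (_+ t) (same-start i≤k)) eq

  new-run : ∀ {N P} → P ≤ N → RunsTo P → Marked (suc N) → ¬ MarkedStep N →
            (∀ {j} → P < j → j ≤ N → ¬ Marked j) → RunsTo (suc N)
  new-run {N} {P} P≤N R mN ¬sN unmarked = record
    { k = suc k ; ℓ = ℓ′ ; g = g′ ; ends = ends′ ; gap-positive = gap-positive′
    ; run-marked = run-marked′ ; run-step-marked = run-step-marked′ ; marked-in-run = marked-in-run′ ; step-in-run = step-in-run′ }
    where
    open RunsTo R
    ℓ′ = update ℓ (suc k) 0
    g′ = update g k (suc N ∸ P)
    old-ℓ : ∀ {i} → i ≤ k → ℓ′ i ≡ ℓ i
    old-ℓ i≤k = update-other ℓ (suc k) 0 (<⇒≢ (s≤s i≤k))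
    same-start : ∀ {i} → i ≤ k → start ℓ′ g′ i ≡ start ℓ g i
    same-start i≤k = sumTo-cong _ (λ j j<i → cong₂ _+_ (old-ℓ (<⇒≤ (<-≤-trans j<i i≤k)))
                                                     (update-other g k _ (<⇒≢ (<-≤-trans j<i i≤k))))
    new-start : start ℓ′ g′ (suc k) ≡ suc N
    new-start = begin
      start ℓ′ g′ k + (ℓ′ k + g′ k)        ≡⟨ cong₂ (λ a b → a + (b + g′ k)) (same-start ≤-refl) (old-ℓ ≤-refl) ⟩
      start ℓ g k + (ℓ k + g′ k)           ≡⟨ cong (λ b → start ℓ g k + (ℓ k + b)) (update-same g k _) ⟩
      start ℓ g k + (ℓ k + (suc N ∸ P))    ≡⟨ +-assoc (start ℓ g k) (ℓ k) _ ⟨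
      start ℓ g k + ℓ k + (suc N ∸ P)      ≡⟨ cong (_+ (suc N ∸ P)) ends ⟩
      P + (suc N ∸ P)                      ≡⟨ m+[n∸m]≡n (m≤n⇒m≤1+n P≤N) ⟩
      suc N                                ∎
      where open ≡-Reasoning
    new-ℓ : ℓ′ (suc k) ≡ 0
    new-ℓ = update-same ℓ (suc k) 0
    ends′ : start ℓ′ g′ (suc k) + ℓ′ (suc k) ≡ suc N
    ends′ = trans (cong₂ _+_ new-start new-ℓ) (+-identityʳ (suc N))
    gap-positive′ : ∀ {i} → i < suc k → 1 ≤ g′ i
    gap-positive′ {i} i<1+k with m≤n⇒m<n∨m≡n (s≤s⁻¹ i<1+k)
    ... | inj₁ i<k  = subst (1 ≤_) (sym (update-other g k _ (<⇒≢ i<k))) (gap-positive i<k)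
    ... | inj₂ refl = subst (1 ≤_) (sym (update-same g i _)) (subst (1 ≤_) (sym (+-∸-assoc 1 P≤N)) (s≤s z≤n))
    run-marked′ : ∀ {i t} → i ≤ suc k → t ≤ ℓ′ i → Marked (start ℓ′ g′ i + t)
    run-marked′ {i} {t} i≤ t≤ with m≤n⇒m<n∨m≡n i≤
    ... | inj₁ i<1+k rewrite same-start (s≤s⁻¹ i<1+k) = run-marked (s≤s⁻¹ i<1+k) (subst (t ≤_) (old-ℓ (s≤s⁻¹ i<1+k)) t≤)
    ... | inj₂ refl with subst (t ≤_) new-ℓ t≤
    ...   | z≤n = subst Marked (sym (trans (+-identityʳ _) new-start)) mN
    run-step-marked′ : ∀ {i t} → i ≤ suc k → t < ℓ′ i → MarkedStep (start ℓ′ g′ i + t)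
    run-step-marked′ {i} {t} i≤ t< with m≤n⇒m<n∨m≡n i≤
    ... | inj₁ i<1+k rewrite same-start (s≤s⁻¹ i<1+k) = run-step-marked (s≤s⁻¹ i<1+k) (subst (t <_) (old-ℓ (s≤s⁻¹ i<1+k)) t<)
    ... | inj₂ refl with subst (t <_) new-ℓ t<
    ...   | ()
    marked-in-run′ : ∀ {τ} → τ ≤ suc N → Marked τ → ∃[ i ] ∃[ t ] (i ≤ suc k × t ≤ ℓ′ i × start ℓ′ g′ i + t ≡ τ)
    marked-in-run′ {τ} τ≤ mτ with m≤n⇒m<n∨m≡n τ≤
    ... | inj₂ refl = suc k , 0 , ≤-refl , z≤n , trans (+-identityʳ _) new-start
    ... | inj₁ τ<1+N with τ ≤? P
    ...   | no τ≰P  = ⊥-elim (unmarked (≰⇒> τ≰P) (s≤s⁻¹ τ<1+N) mτ)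
    ...   | yes τ≤P = let (i , t , i≤k , t≤ , eq) = marked-in-run τ≤P mτ in
                      i , t , m≤n⇒m≤1+n i≤k , subst (t ≤_) (sym (old-ℓ i≤k)) t≤ , trans (cong (_+ t) (same-start i≤k)) eq
    step-in-run′ : ∀ {τ} → τ < suc N → MarkedStep τ → ∃[ i ] ∃[ t ] (i ≤ suc k × t < ℓ′ i × start ℓ′ g′ i + t ≡ τ)
    step-in-run′ {τ} τ< sτ with τ <? P
    ... | yes τ<P = let (i , t , i≤k , t< , eq) = step-in-run τ<P sτ in
                    i , t , m≤n⇒m≤1+n i≤k , subst (t <_) (sym (old-ℓ i≤k)) t< , trans (cong (_+ t) (same-start i≤k)) eq
    ... | no τ≮P with m≤n⇒m<n∨m≡n (s≤s⁻¹ τ<)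
    ...   | inj₂ refl = ⊥-elim (¬sN sτ)
    ...   | inj₁ τ<N  = ⊥-elim (unmarked (s≤s (≮⇒≥ τ≮P)) τ<N (proj₂ (step-ends-marked sτ)))

  record RunsUpTo (N : ℕ) : Set where
    field
      last     : ℕ
      last≤N   : last ≤ N
      unmarked : ∀ {j} → last < j → j ≤ N → ¬ Marked j
      runs     : RunsTo last

  runs-up-to : ∀ N → RunsUpTo N
  runs-up-to zero = record { last = 0 ; last≤N = z≤n ; unmarked = λ 0<j j≤0 → ⊥-elim (<⇒≱ 0<j j≤0) ; runs = initial }
  runs-up-to (suc N) with runs-up-to N | marked? (suc N)
  ... | R | no ¬mN = record { last = last ; last≤N = m≤n⇒m≤1+n last≤N ; unmarked = unmarked′ ; runs = runs }
    where
    open RunsUpTo R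
    unmarked′ : ∀ {j} → last < j → j ≤ suc N → ¬ Marked j
    unmarked′ last<j j≤ with m≤n⇒m<n∨m≡n j≤
    ... | inj₁ j<1+N = unmarked last<j (s≤s⁻¹ j<1+N)
    ... | inj₂ refl  = ¬mN
  ... | R | yes mN = record { last = suc N ; last≤N = ≤-refl ; unmarked = λ N<j j≤N → ⊥-elim (<⇒≱ N<j j≤N) ; runs = runs′ (markedStep? N) }
    where
    open RunsUpTo R
    runs′ : Dec (MarkedStep N) → RunsTo (suc N)
    runs′ (no ¬sN) = new-run last≤N runs mN ¬sN unmarked
    runs′ (yes sN) with m≤n⇒m<n∨m≡n last≤N
    ... | inj₁ last<N = ⊥-elim (unmarked last<N ≤-refl (proj₁ (step-ends-marked sN)))
    ... | inj₂ refl   = extend-run runs mN sN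

  runs-to : ∀ {N} → Marked N → RunsTo N
  runs-to {N} mN with runs-up-to N
  ... | R with m≤n⇒m<n∨m≡n (RunsUpTo.last≤N R)
  ...   | inj₁ last<N = ⊥-elim (RunsUpTo.unmarked R last<N ≤-refl mN)
  ...   | inj₂ refl   = RunsUpTo.runs R

-- Reading off the paths P_i and Q_i from two aligned circulations

double≤⇒+2≤ : ∀ M {L} → 3 ≤ L → M + M ≤ L → M + 2 ≤ L
double≤⇒+2≤ zero          3≤L _    = ≤-trans (s≤s (s≤s z≤n)) 3≤L
double≤⇒+2≤ (suc zero)    3≤L _    = 3≤L
double≤⇒+2≤ (suc (suc M)) 3≤L 2M≤L = ≤-trans (+-monoʳ-≤ (suc (suc M)) (s≤s (s≤s z≤n))) 2M≤L

≤2*[L∸M] : ∀ {M L} → M + M ≤ L → L ≤ 2 * (L ∸ M)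
≤2*[L∸M] {M} {L} 2M≤L = begin
  L                       ≡⟨ m∸n+n≡m M≤L ⟨
  L ∸ M + M               ≤⟨ +-monoʳ-≤ (L ∸ M) (subst (_≤ L ∸ M) (m+n∸m≡n M M) (∸-monoˡ-≤ M 2M≤L)) ⟩
  L ∸ M + (L ∸ M)         ≡⟨ cong (L ∸ M +_) (+-identityʳ (L ∸ M)) ⟨
  2 * (L ∸ M)             ∎
  where
  open ≤-Reasoning
  M≤L = ≤-trans (m≤m+n M M) 2M≤L

module Assembly {n} {C₁ C₂ : EdgeSet n} {L₁ L₂ M : ℕ} {w₁ w₂ : ℕ → Fin n}
                (circ₁ : IsCirculation C₁ L₁ w₁) (circ₂ : IsCirculation C₂ L₂ w₂) (L₁≤L₂ : L₁ ≤ L₂)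
                (2M≤L₁ : M + M ≤ L₁) (2M≤L₂ : M + M ≤ L₂)
                (common-0 : OnCycle C₂ (w₁ 0)) (common-M : OnCycle C₂ (w₁ M))
                (uncommon : ∀ {τ} → M < τ → τ < L₁ → ¬ OnCycle C₂ (w₁ τ))
                (aligned : ∀ {τ} → τ ≤ M → OnCycle C₂ (w₁ τ) → w₂ τ ≡ w₁ τ) where

  module W₁ = Circulation circ₁
  module W₂ = Circulation circ₂

  Common : ℕ → Set
  Common τ = OnCycle C₂ (w₁ τ)

  CommonEdge : ℕ → Set
  CommonEdge τ = C₂ (w₁ τ) (w₁ (suc τ)) ≡ true

  C₂-sym : ∀ {u v} → C₂ u v ≡ true → C₂ v u ≡ true
  C₂-sym Cuv = let (t , _ , step) = W₂.C⇒Step Cuv in W₂.Step⇒C t ([ inj₂ , inj₁ ]′ step)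

  common-edge-ends : ∀ {τ} → CommonEdge τ → Common τ × Common (suc τ)
  common-edge-ends {τ} e = (w₁ (suc τ) , e) , (w₁ τ , C₂-sym e)

  open Runs (λ τ → Finₚ.any? (λ u → C₂ (w₁ τ) u ≟ᵇ true)) (λ τ → C₂ (w₁ τ) (w₁ (suc τ)) ≟ᵇ true)
            common-edge-ends common-0
  open RunsTo (runs-to common-M)

  a : ℕ → ℕ
  a = start ℓ g

  M+1<L₁ : suc M < L₁
  M+1<L₁ = subst (_≤ L₁) (+-comm M 2) (double≤⇒+2≤ M W₁.3≤L 2M≤L₁)

  M<L₁ : M < L₁
  M<L₁ = <-trans (n<1+n M) M+1<L₁

  a-step : ∀ i → a (suc i) ≡ a i + ℓ i + g i
  a-step i = sym (+-assoc (a i) (ℓ i) (g i))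

  run-end≤M : ∀ {i} → i ≤ k → a i + ℓ i ≤ M
  run-end≤M {i} i≤k with m≤n⇒m<n∨m≡n i≤k
  ... | inj₂ refl = ≤-reflexive ends
  ... | inj₁ i<k  = begin
    a i + ℓ i            ≤⟨ m≤m+n (a i + ℓ i) (g i) ⟩
    a i + ℓ i + g i      ≡⟨ a-step i ⟨
    a (suc i)            ≤⟨ sumTo-mono _ i<k ⟩
    a k                  ≤⟨ m≤m+n (a k) (ℓ k) ⟩
    a k + ℓ k            ≡⟨ ends ⟩
    M                    ∎
    where open ≤-Reasoning

  gap≤M : ∀ {i} → i < k → g i ≤ M
  gap≤M {i} i<k = begin
    g i                  ≤⟨ m≤n+m (g i) (a i + ℓ i) ⟩
    a i + ℓ i + g i      ≡⟨ a-step i ⟨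
    a (suc i)            ≤⟨ sumTo-mono _ i<k ⟩
    a k                  ≤⟨ m≤m+n (a k) (ℓ k) ⟩
    a k + ℓ k            ≡⟨ ends ⟩
    M                    ∎
    where open ≤-Reasoning

  in-run≤M : ∀ {i t} → i ≤ k → t ≤ ℓ i → a i + t ≤ M
  in-run≤M {i} i≤k t≤ = ≤-trans (+-monoʳ-≤ (a i) t≤) (run-end≤M i≤k)

  runs-ordered : ∀ {i i' t t'} → i < i' → i' ≤ k → t ≤ ℓ i → a i + t < a i' + t'
  runs-ordered {i} {i'} {t} {t'} i<i' i'≤k t≤ = begin-strict
    a i + t              ≤⟨ +-monoʳ-≤ (a i) t≤ ⟩
    a i + ℓ i            <⟨ m<m+n (a i + ℓ i) (gap-positive (<-≤-trans i<i' i'≤k)) ⟩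
    a i + ℓ i + g i      ≡⟨ a-step i ⟨
    a (suc i)            ≤⟨ sumTo-mono _ i<i' ⟩
    a i'                 ≤⟨ m≤m+n (a i') t' ⟩
    a i' + t'            ∎
    where open ≤-Reasoning

  run-position-injective : ∀ {i i' t t'} → i ≤ k → i' ≤ k → t ≤ ℓ i → t' ≤ ℓ i' → a i + t ≡ a i' + t' → i ≡ i' × t ≡ t'
  run-position-injective {i} {i'} {t} {t'} i≤k i'≤k t≤ t'≤ eq with <-cmp i i'
  ... | tri< i<i' _ _ = ⊥-elim (<-irrefl eq (runs-ordered i<i' i'≤k t≤))
  ... | tri> _ _ i'<i = ⊥-elim (<-irrefl (sym eq) (runs-ordered i'<i i≤k t'≤))
  ... | tri≈ _ refl _ = refl , +-cancelˡ-≡ (a i) t t' eq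

  -- the last Q-path leaves the last run at position M and goes once around to position L ≡ 0
  q : ℕ → ℕ → ℕ
  q L i = if does (i <? k) then g i else L ∸ M

  q-inner : ∀ L {i} → i < k → q L i ≡ g i
  q-inner L {i} i<k = cong (if_then g i else L ∸ M) (dec-true (i <? k) i<k)

  q-last : ∀ L → q L k ≡ L ∸ M
  q-last L = cong (if_then g k else L ∸ M) (dec-false (k <? k) (n≮n k))

  layout : ∀ L {i} → suc i < suc k → a (suc i) ≡ a i + ℓ i + q L i
  layout L {i} i<k = trans (a-step i) (cong (a i + ℓ i +_) (sym (q-inner L (s≤s⁻¹ i<k))))

  total : ∀ L → M ≤ L → sumTo (suc k) (λ i → ℓ i + q L i) ≡ L
  total L M≤L = begin
    sumTo k (λ i → ℓ i + q L i) + (ℓ k + q L k)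
      ≡⟨ cong₂ _+_ (sumTo-cong k (λ i i<k → cong (ℓ i +_) (q-inner L i<k))) (cong (ℓ k +_) (q-last L)) ⟩
    a k + (ℓ k + (L ∸ M))   ≡⟨ +-assoc (a k) (ℓ k) _ ⟨
    a k + ℓ k + (L ∸ M)     ≡⟨ cong (_+ (L ∸ M)) ends ⟩
    M + (L ∸ M)             ≡⟨ m+[n∸m]≡n M≤L ⟩
    L                       ∎
    where open ≡-Reasoning

  M≤L₁ : M ≤ L₁
  M≤L₁ = ≤-trans (m≤m+n M M) 2M≤L₁

  short : ∀ L {i} → suc i < suc k → 2 * q L i ≤ size C₁
  short L {i} i<k = begin
    2 * q L i     ≡⟨ cong (2 *_) (q-inner L (s≤s⁻¹ i<k)) ⟩
    2 * g i       ≤⟨ *-monoʳ-≤ 2 (gap≤M (s≤s⁻¹ i<k)) ⟩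
    M + (M + 0)   ≡⟨ cong (M +_) (+-identityʳ M) ⟩
    M + M         ≤⟨ 2M≤L₁ ⟩
    L₁            ≡⟨ W₁.size-C ⟨
    size C₁       ∎
    where open ≤-Reasoning

  long : ∀ (C : EdgeSet n) {L} → size C ≡ L → M + M ≤ L → size C ≤ 2 * q L k
  long C {L} size-C 2M≤L = subst₂ _≤_ (sym size-C) (cong (2 *_) (sym (q-last L))) (≤2*[L∸M] {M} 2M≤L)

  last-length : q L₂ k ≡ q L₁ k + (size C₂ ∸ size C₁)
  last-length = begin
    q L₂ k                          ≡⟨ q-last L₂ ⟩
    L₂ ∸ M                          ≡⟨ cong (_∸ M) (m∸n+n≡m L₁≤L₂) ⟨
    L₂ ∸ L₁ + L₁ ∸ M                ≡⟨ +-∸-assoc (L₂ ∸ L₁) M≤L₁ ⟩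
    L₂ ∸ L₁ + (L₁ ∸ M)              ≡⟨ +-comm (L₂ ∸ L₁) (L₁ ∸ M) ⟩
    L₁ ∸ M + (L₂ ∸ L₁)              ≡⟨ cong₂ (λ p r → p + (r ∸ L₁)) (q-last L₁) W₂.size-C ⟨
    q L₁ k + (size C₂ ∸ L₁)         ≡⟨ cong (λ r → q L₁ k + (size C₂ ∸ r)) W₁.size-C ⟨
    q L₁ k + (size C₂ ∸ size C₁)    ∎
    where open ≡-Reasoning

  common-edge⇒C₂ : ∀ {t u v} → Step w₁ t u v → CommonEdge t → C₂ u v ≡ true
  common-edge⇒C₂ (inj₁ (refl , refl)) e = e
  common-edge⇒C₂ (inj₂ (refl , refl)) e = C₂-sym e

  C₂⇒common-edge : ∀ {t u v} → Step w₁ t u v → C₂ u v ≡ true → CommonEdge t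
  C₂⇒common-edge (inj₁ (refl , refl)) c = c
  C₂⇒common-edge (inj₂ (refl , refl)) c = C₂-sym c

  common⇒position : ∀ {v} → OnCycle C₁ v → OnCycle C₂ v → ∃[ i ] ∃[ t ] (i < suc k × t ≤ ℓ i × w₁ (a i + t) ≡ v)
  common⇒position on₁ on₂ with W₁.on-C⇒position on₁
  ... | p , wp≡v with W₁.lift-into-window 0 p
  ...   | r , r<L₁ , wr≡wp with r ≤? M
  ...     | no r≰M  = ⊥-elim (uncommon (≰⇒> r≰M) r<L₁ (subst (OnCycle C₂) (sym (trans wr≡wp wp≡v)) on₂))
  ...     | yes r≤M = let (i , t , i≤k , t≤ , at≡r) = marked-in-run r≤M (subst (OnCycle C₂) (sym (trans wr≡wp wp≡v)) on₂)
                      in i , t , s≤s i≤k , t≤ , trans (cong w₁ at≡r) (trans wr≡wp wp≡v)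

  common-edge⇒position : ∀ {u v} → C₁ u v ≡ true → C₂ u v ≡ true →
                         ∃[ i ] ∃[ t ] (i < suc k × t < ℓ i × Step (λ τ → w₁ (a i + τ)) t u v)
  common-edge⇒position c₁ c₂ with W₁.C⇒Step c₁
  ... | τ , τ<L₁ , step with τ <? M | C₂⇒common-edge step c₂
  ...   | yes τ<M | e = let (i , t , i≤k , t< , at≡τ) = step-in-run τ<M e in
                        i , t , s≤s i≤k , t< , Step-transport w₁ (λ σ → w₁ (a i + σ)) (cong w₁ (sym at≡τ))
                                                 (cong w₁ (trans (cong suc (sym at≡τ)) (sym (+-suc (a i) t)))) step
  ...   | no τ≮M  | e with m≤n⇒m<n∨m≡n (≮⇒≥ τ≮M)
  ...     | inj₁ M<τ  = ⊥-elim (uncommon M<τ τ<L₁ (proj₁ (common-edge-ends e)))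
  ...     | inj₂ refl = ⊥-elim (uncommon ≤-refl M+1<L₁ (proj₂ (common-edge-ends e)))

  structure : Structure C₁ C₂
  structure = record
    { L₁ = L₁ ; L₂ = L₂ ; w₁ = w₁ ; w₂ = w₂ ; circ₁ = circ₁ ; circ₂ = circ₂
    ; k = suc k ; k≥1 = s≤s z≤n ; a = a ; b = a ; ℓ = ℓ ; q₁ = q L₁ ; q₂ = q L₂
    ; agree = λ i t i<k t≤ → sym (aligned (in-run≤M (s≤s⁻¹ i<k) t≤) (run-marked (s≤s⁻¹ i<k) t≤))
    ; disj = λ i i' t t' i<k i'<k t≤ t'≤ eq → run-position-injective (s≤s⁻¹ i<k) (s≤s⁻¹ i'<k) t≤ t'≤
               (W₁.injective _ _ (≤-<-trans (in-run≤M (s≤s⁻¹ i<k) t≤) M<L₁)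
                                 (≤-<-trans (in-run≤M (s≤s⁻¹ i'<k) t'≤) M<L₁) eq)
    ; layout₁ = λ i → layout L₁ ; total₁ = total L₁ M≤L₁
    ; layout₂ = λ i → layout L₂ ; total₂ = total L₂ (≤-trans M≤L₁ L₁≤L₂)
    ; vertices = λ v → (λ (on₁ , on₂) → common⇒position on₁ on₂)
                     , (λ (i , t , i<k , t≤ , w≡v) → subst (OnCycle C₁) w≡v (W₁.w-on-C (a i + t))
                                                   , subst (OnCycle C₂) w≡v (run-marked (s≤s⁻¹ i<k) t≤))
    ; edges = λ u v → (λ (c₁ , c₂) → common-edge⇒position c₁ c₂)
                    , (λ (i , t , i<k , t< , step) →
                         let step′ = Step-transport (λ σ → w₁ (a i + σ)) w₁ refl (cong w₁ (+-suc (a i) t)) step in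
                         W₁.Step⇒C _ step′ , common-edge⇒C₂ step′ (run-step-marked (s≤s⁻¹ i<k) t<))
    ; eqLen = λ i i<k → trans (q-inner L₁ (s≤s⁻¹ i<k)) (sym (q-inner L₂ (s≤s⁻¹ i<k)))
    ; short₁ = λ i → short L₁ ; short₂ = λ i → short L₂
    ; lastLen = last-length ; long₁ = long C₁ W₁.size-C 2M≤L₁ ; long₂ = long C₂ W₂.size-C 2M≤L₂ }

-- Two elements of a minimum cycle basis

-- |Φ − Φ′| ≤ k, avoiding truncated subtraction
Near : ℕ → ℕ → ℕ → Set
Near k Φ Φ′ = Φ′ ≤ Φ + k × Φ ≤ Φ′ + k

data Direction : Set where
  forward backward : Direction

move : Direction → ℕ → ℕ → ℕ
move forward  Φ τ = Φ + τ
move backward Φ τ = Φ ∸ τ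

Moved : Direction → ℕ → ℕ → ℕ → Set
Moved forward  R Φ Φ′ = Φ′ ≡ Φ + R
Moved backward R Φ Φ′ = Φ ≡ Φ′ + R

move-0 : ∀ d Φ → move d Φ 0 ≡ Φ
move-0 forward  Φ = +-identityʳ Φ
move-0 backward Φ = refl

move-+ : ∀ d {δ Φ Φ₁} → Moved d δ Φ Φ₁ → ∀ τ → move d Φ (δ + τ) ≡ move d Φ₁ τ
move-+ forward  {δ} {Φ} refl τ = sym (+-assoc Φ δ τ)
move-+ backward {δ} {Φ} {Φ₁} refl τ = trans (cong (_∸ (δ + τ)) (+-comm Φ₁ δ)) ([m+n]∸[m+o]≡n∸o δ Φ₁ τ)

near-trans : ∀ {δ R Φ Φ₁ Φ₂} → Near δ Φ Φ₁ → Near R Φ₁ Φ₂ → Near (δ + R) Φ Φ₂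
near-trans {δ} {R} {Φ} {Φ₁} {Φ₂} (Φ₁≤ , Φ≤) (Φ₂≤ , Φ₁≤′) =
  ≤-trans Φ₂≤ (≤-trans (+-monoˡ-≤ R Φ₁≤) (≤-reflexive (+-assoc Φ δ R))) ,
  ≤-trans Φ≤ (≤-trans (+-monoˡ-≤ δ Φ₁≤′) (≤-reflexive (trans (+-assoc Φ₂ R δ) (cong (Φ₂ +_) (+-comm R δ)))))

squeeze : ∀ d {δ R Φ Φ₁ Φ₂} → Near δ Φ Φ₁ → Near R Φ₁ Φ₂ → Moved d (δ + R) Φ Φ₂ → Moved d δ Φ Φ₁ × Moved d R Φ₁ Φ₂
squeeze forward {δ} {R} {Φ} {Φ₁} (Φ₁≤ , _) (Φ₂≤ , _) refl = Φ₁≡ , trans (sym (+-assoc Φ δ R)) (cong (_+ R) (sym Φ₁≡))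
  where
  Φ₁≡ : Φ₁ ≡ Φ + δ
  Φ₁≡ = ≤-antisym Φ₁≤ (+-cancelʳ-≤ R (Φ + δ) Φ₁ (subst (_≤ Φ₁ + R) (sym (+-assoc Φ δ R)) Φ₂≤))
squeeze backward {δ} {R} {_} {Φ₁} {Φ₂} (_ , Φ≤) (_ , Φ₁≤) refl =
  trans (cong (Φ₂ +_) (+-comm δ R)) (trans (sym (+-assoc Φ₂ R δ)) (cong (_+ δ) (sym Φ₁≡))) , Φ₁≡
  where
  Φ₁≡ : Φ₁ ≡ Φ₂ + R
  Φ₁≡ = ≤-antisym Φ₁≤ (+-cancelʳ-≤ δ (Φ₂ + R) Φ₁
          (subst (_≤ Φ₁ + δ) (trans (cong (Φ₂ +_) (+-comm δ R)) (sym (+-assoc Φ₂ R δ))) Φ≤))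

module TwoElements (G : Graph) {m} (B : Fin m → EdgeSet (n G)) (mcb : IsMCB G B) {x y : Fin m} (x≢y : x ≢ y)
                   {L₁ L₂ : ℕ} {w₁ w₂ : ℕ → Fin (n G)}
                   (circ₁ : IsCirculation (B x) L₁ w₁) (circ₂ : IsCirculation (B y) L₂ w₂) where

  open CycleSpace G
  open MinimumBasis G B mcb
  module W₁ = Circulation circ₁
  module W₂ = Circulation circ₂

  C₁ C₂ : EdgeSet (n G)
  C₁ = B x
  C₂ = B y

  Common : ℕ → Set
  Common p = OnCycle C₂ (w₁ p)

  common? : ∀ p → Dec (Common p)
  common? p = Finₚ.any? (λ u → C₂ (w₁ p) u ≟ᵇ true)

  common-+L₁ : ∀ {p} → Common p → Common (p + L₁)
  common-+L₁ {p} = subst (OnCycle C₂) (sym (W₁.periodic p))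

  detour-cycle : ∀ {a b c d} → w₁ a ≡ w₂ c → w₁ b ≡ w₂ d → IsCycle G (segment w₁ a b ⊕ segment w₂ c d)
  detour-cycle {a} {b} {c} {d} a≡c b≡d = mkCycle
    (λ u v → cong₂ _xor_ (segment-sym w₁ a b u v) (segment-sym w₂ c d u v))
    (λ u v uv∈ → [ cycle-adj (element-cycle x) ∘ W₁.segment⇒C a b , cycle-adj (element-cycle y) ∘ W₂.segment⇒C c d ]′
                   (xor-true (segment w₁ a b u v) (segment w₂ c d u v) uv∈))
    even-degrees
    where
    even-degrees : ∀ v → xorF ((segment w₁ a b ⊕ segment w₂ c d) v) ≡ false
    even-degrees v = begin
      xorF ((segment w₁ a b ⊕ segment w₂ c d) v)
        ≡⟨ xorF-xor (segment w₁ a b v) (segment w₂ c d v) ⟩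
      xorF (segment w₁ a b v) xor xorF (segment w₂ c d v)
        ≡⟨ cong₂ _xor_ (segment-parity w₁ a b v) (segment-parity w₂ c d v) ⟩
      ((v =ᶠ w₁ a) xor (v =ᶠ w₁ b)) xor ((v =ᶠ w₂ c) xor (v =ᶠ w₂ d))
        ≡⟨ cong₂ (λ p q → ((v =ᶠ w₁ a) xor (v =ᶠ w₁ b)) xor ((v =ᶠ p) xor (v =ᶠ q))) (sym a≡c) (sym b≡d) ⟩
      ((v =ᶠ w₁ a) xor (v =ᶠ w₁ b)) xor ((v =ᶠ w₁ a) xor (v =ᶠ w₁ b))
        ≡⟨ xor-same ((v =ᶠ w₁ a) xor (v =ᶠ w₁ b)) ⟩
      false ∎
      where open ≡-Reasoning

  -- The segment of C₁ closes up with either C₂-arc to a cycle, and these two cycles sum to C₂;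
  -- so by minimality one of them is at least as long as C₂.
  C₂-isometric : ∀ {a k X r} → w₂ X ≡ w₁ a → w₂ (X + r) ≡ w₁ (a + k) → r ≤ L₂ → r ≤ k ⊎ L₂ ∸ r ≤ k
  C₂-isometric {a} {k} {X} {r} start end r≤L₂ =
    short-arc (element-split y (detour-cycle (sym start) (sym end)) (detour-cycle (sym (trans (W₂.periodic X) start)) (sym end)) split)
    where
    Q = segment w₁ a (a + k)
    A = segment w₂ X (X + r)
    A′ = segment w₂ (X + L₂) (X + r)
    split : C₂ ≐ (Q ⊕ A) ⊕ (Q ⊕ A′)
    split u v = sym (begin
      (Q u v xor A u v) xor (Q u v xor A′ u v)              ≡⟨ xor-cancel-left (Q u v) (A u v) (A′ u v) ⟩
      A u v xor A′ u v                                      ≡⟨ cong (A u v xor_) (segment-comm w₂ (X + L₂) (X + r) u v) ⟩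
      A u v xor segment w₂ (X + r) (X + L₂) u v             ≡⟨ segment-trans w₂ X (X + r) (X + L₂) u v ⟩
      segment w₂ X (X + L₂) u v                             ≡⟨ W₂.segment-turn X u v ⟩
      C₂ u v                                                ∎)
      where open ≡-Reasoning
    size-A′ : size A′ ≤ L₂ ∸ r
    size-A′ = ≤-trans (≤-reflexive (size-cong (segment-comm w₂ (X + L₂) (X + r))))
                      (size-segment-≡ w₂ (trans (+-assoc X r (L₂ ∸ r)) (cong (X +_) (m+[n∸m]≡n r≤L₂))))
    short-arc : size C₂ ≤ size (Q ⊕ A) ⊎ size C₂ ≤ size (Q ⊕ A′) → r ≤ k ⊎ L₂ ∸ r ≤ k
    short-arc (inj₁ C₂≤) = inj₂ (m≤n+o⇒m∸n≤o L₂ r (begin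
      L₂                     ≡⟨ W₂.size-C ⟨
      size C₂                ≤⟨ C₂≤ ⟩
      size (Q ⊕ A)           ≤⟨ size-⊕≤ Q A ⟩
      size Q + size A        ≤⟨ +-mono-≤ (size-segment w₁ a k) (size-segment w₂ X r) ⟩
      k + r                  ≡⟨ +-comm k r ⟩
      r + k                  ∎))
      where open ≤-Reasoning
    short-arc (inj₂ C₂≤) = inj₁ (+-cancelʳ-≤ (L₂ ∸ r) r k (begin
      r + (L₂ ∸ r)           ≡⟨ m+[n∸m]≡n r≤L₂ ⟩
      L₂                     ≡⟨ W₂.size-C ⟨
      size C₂                ≤⟨ C₂≤ ⟩
      size (Q ⊕ A′)          ≤⟨ size-⊕≤ Q A′ ⟩
      size Q + size A′       ≤⟨ +-mono-≤ (size-segment w₁ a k) size-A′ ⟩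
      k + (L₂ ∸ r)           ∎))
      where open ≤-Reasoning

  lift : ∀ {p k Φ} → w₂ Φ ≡ w₁ p → L₂ ≤ Φ → Common (p + k) → ∃[ Φ′ ] (w₂ Φ′ ≡ w₁ (p + k) × Near k Φ Φ′)
  lift {p} {k} {Φ} lifted L₂≤Φ common with W₂.on-C⇒position common
  ... | q , wq≡ with W₂.lift-into-window Φ q
  ...   | r , r<L₂ , w[Φ+r]≡wq with C₂-isometric lifted (trans w[Φ+r]≡wq wq≡) (<⇒≤ r<L₂)
  ...     | inj₁ r≤k = Φ + r , trans w[Φ+r]≡wq wq≡ , +-monoʳ-≤ Φ r≤k , ≤-trans (m≤m+n Φ r) (m≤m+n (Φ + r) k)
  ...     | inj₂ d≤k = Φ ∸ d , trans (sym (W₂.periodic (Φ ∸ d))) (trans (cong w₂ back) (trans w[Φ+r]≡wq wq≡)) ,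
                       ≤-trans (m∸n≤m Φ d) (m≤m+n Φ k) , subst (_≤ Φ ∸ d + k) (m∸n+n≡m d≤Φ) (+-monoʳ-≤ (Φ ∸ d) d≤k)
    where
    d = L₂ ∸ r
    d≤Φ : d ≤ Φ
    d≤Φ = ≤-trans (m∸n≤m L₂ r) L₂≤Φ
    back : Φ ∸ d + L₂ ≡ Φ + r
    back = begin
      Φ ∸ d + L₂          ≡⟨ cong (Φ ∸ d +_) (m∸n+n≡m (<⇒≤ r<L₂)) ⟨
      Φ ∸ d + (d + r)     ≡⟨ +-assoc (Φ ∸ d) d r ⟨
      Φ ∸ d + d + r       ≡⟨ cong (_+ r) (m∸n+n≡m d≤Φ) ⟩
      Φ + r               ∎
      where open ≡-Reasoning

  record Gap (p δ : ℕ) : Set where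
    field
      1≤δ        : 1 ≤ δ
      δ≤L₁       : δ ≤ L₁
      common-end : Common (p + δ)
      between    : ∀ {j} → 0 < j → j < δ → ¬ Common (p + j)

  next-gap : ∀ {p} → Common p → ∃[ δ ] Gap p δ
  next-gap {p} common-p with least (λ j → common? (p + suc j)) (subst Common (cong (p +_) (sym 1+[L₁∸1]≡L₁)) (common-+L₁ common-p))
    where
    1+[L₁∸1]≡L₁ : suc (L₁ ∸ 1) ≡ L₁
    1+[L₁∸1]≡L₁ = m+[n∸m]≡n (≤-trans (s≤s z≤n) W₁.3≤L)
  ... | d , d≤ , common-d , before = suc d , record
    { 1≤δ = s≤s z≤n ; δ≤L₁ = ≤-trans (s≤s d≤) (≤-reflexive (m+[n∸m]≡n (≤-trans (s≤s z≤n) W₁.3≤L)))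
    ; common-end = common-d ; between = λ { {suc j} _ j<1+d → before j (s≤s⁻¹ j<1+d) } }

  record CriticalGap : Set where
    field
      t δ X X′   : ℕ
      gap        : Gap t δ
      lift-start : w₂ X ≡ w₁ t
      lift-end   : w₂ X′ ≡ w₁ (t + δ)
      c          : Fin m → Bool
      represents : Represents c (segment w₁ t (t + δ) ⊕ segment w₂ X X′)
      uses-C₁    : c x ≡ true

  Aligned : Direction → ℕ → ℕ → ℕ → Set
  Aligned d R p Φ = ∀ {τ} → τ ≤ R → Common (p + τ) → w₂ (move d Φ τ) ≡ w₁ (p + τ)

  record Walk (R p Φ : ℕ) : Set where
    field
      end        : ℕ
      lift-end   : w₂ end ≡ w₁ (p + R)
      near       : Near R Φ end
      c          : Fin m → Bool
      represents : Represents c (segment w₁ p (p + R) ⊕ segment w₂ Φ end)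
      critical   : c x ≡ true → CriticalGap
      aligned    : ∀ d → Moved d R Φ end → Aligned d R p Φ

  aligned-cons : ∀ d {p δ R Φ Φ₁} → Gap p δ → w₂ Φ ≡ w₁ p → Moved d δ Φ Φ₁ → Aligned d R (p + δ) Φ₁ → Aligned d (δ + R) p Φ
  aligned-cons d {p} {δ} {R} {Φ} {Φ₁} gap lifted moved rest {τ} τ≤ common with τ <? δ
  ... | yes τ<δ = at-start τ<δ common
    where
    at-start : ∀ {τ} → τ < δ → Common (p + τ) → w₂ (move d Φ τ) ≡ w₁ (p + τ)
    at-start {zero}  _    _      = trans (cong w₂ (move-0 d Φ)) (trans lifted (cong w₁ (sym (+-identityʳ p))))
    at-start {suc τ} τ<δ common′ = ⊥-elim (Gap.between gap (s≤s z≤n) τ<δ common′)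
  ... | no τ≮δ = subst₂ (λ a b → w₂ a ≡ w₁ b) (sym (trans (cong (move d Φ) (sym δ+τ′≡τ)) (move-+ d moved τ′))) p+δ+τ′≡p+τ
                        (rest (subst (τ′ ≤_) (m+n∸m≡n δ R) (∸-monoˡ-≤ δ τ≤)) (subst Common (sym p+δ+τ′≡p+τ) common))
    where
    τ′ = τ ∸ δ
    δ+τ′≡τ : δ + τ′ ≡ τ
    δ+τ′≡τ = m+[n∸m]≡n (≮⇒≥ τ≮δ)
    p+δ+τ′≡p+τ : p + δ + τ′ ≡ p + τ
    p+δ+τ′≡p+τ = trans (+-assoc p δ τ′) (cong (p +_) δ+τ′≡τ)

  walk-nil : ∀ {p Φ} → w₂ Φ ≡ w₁ p → Walk 0 p Φ
  walk-nil {p} {Φ} lifted = record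
    { end = Φ ; lift-end = trans lifted (cong w₁ (sym (+-identityʳ p))) ; near = m≤m+n Φ 0 , m≤m+n Φ 0
    ; c = λ _ → false
    ; represents = represents-≐ represents-∅ (λ u v → sym (cong₂ _xor_
                     (trans (cong (λ q → segment w₁ p q u v) (+-identityʳ p)) (segment-self w₁ p u v)) (segment-self w₂ Φ u v)))
    ; critical = λ ()
    ; aligned = λ { d _ {zero} _ _ → trans (cong w₂ (move-0 d Φ)) (trans lifted (cong w₁ (sym (+-identityʳ p)))) } }

  walk-cons : ∀ {p δ R Φ Φ₁} → Gap p δ → w₂ Φ ≡ w₁ p → w₂ Φ₁ ≡ w₁ (p + δ) → Near δ Φ Φ₁ →
              Walk R (p + δ) Φ₁ → Walk (δ + R) p Φ
  walk-cons {p} {δ} {R} {Φ} {Φ₁} gap lifted lifted₁ near₁ rest = record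
    { end = end ; lift-end = trans lift-end (cong w₁ (+-assoc p δ R)) ; near = near-trans near₁ near
    ; c = λ i → c₀ i xor c i ; represents = represents-≐ (represents-⊕ r₀ represents) rearranged
    ; critical = λ cx → [ (λ c₀x → record { gap = gap ; lift-start = lifted ; lift-end = lifted₁ ; represents = r₀ ; uses-C₁ = c₀x })
                        , critical ]′ (xor-true (c₀ x) (c x) cx)
    ; aligned = λ d moved → let (moved₁ , moved₂) = squeeze d near₁ near moved in
                            aligned-cons d gap lifted moved₁ (aligned d moved₂) }
    where
    open Walk rest
    c₀ = proj₁ (represents-exists (detour-cycle (sym lifted) (sym lifted₁)))
    r₀ = proj₂ (represents-exists (detour-cycle (sym lifted) (sym lifted₁)))
    rearranged : (segment w₁ p (p + δ) ⊕ segment w₂ Φ Φ₁) ⊕ (segment w₁ (p + δ) (p + δ + R) ⊕ segment w₂ Φ₁ end)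
                 ≐ segment w₁ p (p + (δ + R)) ⊕ segment w₂ Φ end
    rearranged u v = trans (xor-interchange (segment w₁ p (p + δ) u v) (segment w₂ Φ Φ₁ u v) _ _)
      (cong₂ _xor_ (trans (segment-trans w₁ p (p + δ) (p + δ + R) u v) (cong (λ q → segment w₁ p q u v) (+-assoc p δ R)))
                   (segment-trans w₂ Φ Φ₁ end u v))

  walk : ∀ F {R p Φ} → R ≤ F → Common p → Common (p + R) → w₂ Φ ≡ w₁ p → L₂ + R ≤ Φ → Walk R p Φ
  walk F       {zero}          _   _        _        lifted _ = walk-nil lifted
  walk (suc F) {suc R} {p} {Φ} R≤F common-p common-R lifted big with next-gap common-p
  ... | δ , gap with lift lifted (≤-trans (m≤m+n L₂ (suc R)) big) (Gap.common-end gap)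
  ...   | Φ₁ , lifted₁ , near₁ = subst (λ R → Walk R p Φ) (m+[n∸m]≡n δ≤1+R)
          (walk-cons gap lifted lifted₁ near₁
             (walk F (≤-trans (∸-monoʳ-≤ (suc R) (Gap.1≤δ gap)) (s≤s⁻¹ R≤F)) (Gap.common-end gap)
                   (subst Common (sym p+δ+R′≡) common-R) lifted₁ big₁))
    where
    δ≤1+R : δ ≤ suc R
    δ≤1+R with δ ≤? suc R
    ... | yes δ≤ = δ≤
    ... | no δ≰  = ⊥-elim (Gap.between gap (s≤s z≤n) (≰⇒> δ≰) common-R)
    p+δ+R′≡ : p + δ + (suc R ∸ δ) ≡ p + suc R
    p+δ+R′≡ = trans (+-assoc p δ _) (cong (p +_) (m+[n∸m]≡n δ≤1+R))
    big₁ : L₂ + (suc R ∸ δ) ≤ Φ₁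
    big₁ = +-cancelʳ-≤ δ _ _ (begin
      L₂ + (suc R ∸ δ) + δ    ≡⟨ +-assoc L₂ _ δ ⟩
      L₂ + (suc R ∸ δ + δ)    ≡⟨ cong (L₂ +_) (m∸n+n≡m δ≤1+R) ⟩
      L₂ + suc R              ≤⟨ big ⟩
      Φ                       ≤⟨ proj₂ near₁ ⟩
      Φ₁ + δ                  ∎)
      where open ≤-Reasoning

  ZeroOrC₂ : EdgeSet (n G) → Set
  ZeroOrC₂ S = S ≐ ∅ ⊎ S ≐ C₂

  zero-or-C₂-⊕ : ∀ {S T} → ZeroOrC₂ S → ZeroOrC₂ T → ZeroOrC₂ (S ⊕ T)
  zero-or-C₂-⊕ (inj₁ S≐∅)  (inj₁ T≐∅)  = inj₁ (λ u v → cong₂ _xor_ (S≐∅ u v) (T≐∅ u v))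
  zero-or-C₂-⊕ (inj₁ S≐∅)  (inj₂ T≐C₂) = inj₂ (λ u v → cong₂ _xor_ (S≐∅ u v) (T≐C₂ u v))
  zero-or-C₂-⊕ (inj₂ S≐C₂) (inj₁ T≐∅)  = inj₂ (λ u v → trans (cong₂ _xor_ (S≐C₂ u v) (T≐∅ u v)) (xor-identityʳ (C₂ u v)))
  zero-or-C₂-⊕ (inj₂ S≐C₂) (inj₂ T≐C₂) = inj₁ (λ u v → trans (cong₂ _xor_ (S≐C₂ u v) (T≐C₂ u v)) (xor-same (C₂ u v)))

  zero-or-C₂-avoids-C₁ : ∀ {c S} → Represents c S → ZeroOrC₂ S → c x ≡ false
  zero-or-C₂-avoids-C₁ rS (inj₁ S≐∅)  = represents-unique (represents-≐ rS S≐∅) represents-∅ x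
  zero-or-C₂-avoids-C₁ rS (inj₂ S≐C₂) = trans (represents-unique (represents-≐ rS S≐C₂) (represents-element y) x) (=ᶠ-≢ x≢y)

  -- Lifts are started this far along w₂ so that moving backwards never truncates at 0.
  far : ℕ → ℕ
  far Y = Y + suc L₁ * L₂

  far-lift : ∀ Y → w₂ (far Y) ≡ w₂ Y
  far-lift Y = W₂.w-+-multiple Y (suc L₁)

  far-big : ∀ Y → L₂ + L₁ ≤ far Y
  far-big Y = ≤-trans (+-monoʳ-≤ L₂ (m≤m*n L₁ L₂ {{W₂.L-nonZero}})) (m≤n+m (L₂ + L₁ * L₂) Y)

  -- Lifting a whole turn of C₁ gives C₁ ⊕ (∅ or C₂), whose representation contains C₁; so does one of the gap cycles.
  critical-gap : ∀ {v} → OnCycle C₁ v → OnCycle C₂ v → CriticalGap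
  critical-gap {v} on₁ on₂ with W₁.on-C⇒position on₁ | W₂.on-C⇒position on₂
  ... | q , w₁q≡v | q₂ , w₂q₂≡v = Walk.critical turn uses-C₁
    where
    common-q : Common q
    common-q = subst (OnCycle C₂) (sym w₁q≡v) on₂
    lifted : w₂ (far q₂) ≡ w₁ q
    lifted = trans (far-lift q₂) (trans w₂q₂≡v (sym w₁q≡v))
    turn : Walk L₁ q (far q₂)
    turn = walk L₁ ≤-refl common-q (common-+L₁ common-q) lifted (far-big q₂)
    open Walk turn
    closes : w₂ (far q₂) ≡ w₂ end
    closes = trans lifted (trans (sym (W₁.periodic q)) (sym lift-end))
    uses-C₁ : c x ≡ true
    uses-C₁ with W₂.segment-of-lifts-C closes
    ... | inj₁ S≐∅  = trans (represents-unique represents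
                              (represents-≐ (represents-⊕ (represents-element x) represents-∅)
                                            (λ u v → sym (cong₂ _xor_ (W₁.segment-turn q u v) (S≐∅ u v)))) x)
                            (cong (_xor false) (=ᶠ-refl x))
    ... | inj₂ S≐C₂ = trans (represents-unique represents
                              (represents-≐ (represents-⊕ (represents-element x) (represents-element y))
                                            (λ u v → sym (cong₂ _xor_ (W₁.segment-turn q u v) (S≐C₂ u v)))) x)
                            (cong₂ _xor_ (=ᶠ-refl x) (=ᶠ-≢ x≢y))

  module AroundCriticalGap (L₁≤L₂ : L₁ ≤ L₂) (h : CriticalGap) where

    open CriticalGap h

    s M : ℕ
    s = t + δ
    M = L₁ ∸ δ

    δ+M≡L₁ : δ + M ≡ L₁
    δ+M≡L₁ = m+[n∸m]≡n (Gap.δ≤L₁ gap)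

    s+M≡t+L₁ : s + M ≡ t + L₁
    s+M≡t+L₁ = trans (+-assoc t δ M) (cong (t +_) δ+M≡L₁)

    -- Closing the critical gap with any other C₂-arc changes its cycle by ∅ or C₂, so C₁ stays in the representation.
    arc-long : ∀ {Ye Ys} → w₂ Ye ≡ w₁ t → w₂ Ys ≡ w₁ s → M ≤ size (segment w₂ Ye Ys)
    arc-long {Ye} {Ys} Ye-lifts Ys-lifts = +-cancelˡ-≤ δ M _ (begin
      δ + M                                                ≡⟨ δ+M≡L₁ ⟩
      L₁                                                   ≡⟨ W₁.size-C ⟨
      size C₁                                              ≤⟨ exchange cD′ r′ c′x ⟩
      size (Q ⊕ segment w₂ Ye Ys)                          ≤⟨ size-⊕≤ Q (segment w₂ Ye Ys) ⟩
      size Q + size (segment w₂ Ye Ys)                     ≤⟨ +-monoˡ-≤ _ (size-segment w₁ t δ) ⟩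
      δ + size (segment w₂ Ye Ys)                          ∎)
      where
      open ≤-Reasoning
      Q = segment w₁ t (t + δ)
      cD′ = detour-cycle (sym Ye-lifts) (sym Ys-lifts)
      c′ = proj₁ (represents-exists cD′)
      r′ = proj₂ (represents-exists cD′)
      difference : (Q ⊕ segment w₂ X X′) ⊕ (Q ⊕ segment w₂ Ye Ys) ≐ segment w₂ X Ye ⊕ segment w₂ X′ Ys
      difference u v = trans (xor-cancel-left (Q u v) (segment w₂ X X′ u v) (segment w₂ Ye Ys u v))
                             (xor-interchange (prefix w₂ X u v) (prefix w₂ X′ u v) (prefix w₂ Ye u v) (prefix w₂ Ys u v))
      c′x : c′ x ≡ true
      c′x = trans (sym (xor-false⇒≡ (c x) (c′ x)
                    (zero-or-C₂-avoids-C₁ (represents-≐ (represents-⊕ represents r′) difference)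
                      (zero-or-C₂-⊕ (W₂.segment-of-lifts-C (trans lift-start (sym Ye-lifts)))
                                    (W₂.segment-of-lifts-C (trans lift-end (sym Ys-lifts)))))))
                  uses-C₁

    -- Both C₂-arcs between the ends of the gap have length ≥ M, and one of them has length ≤ δ.
    M-short : M + M ≤ L₁ × M + M ≤ L₂
    M-short with W₂.lift-into-window X X′
    ... | r , r<L₂ , w[X+r]≡wX′ = ≤-trans (+-monoˡ-≤ M M≤δ) (≤-reflexive δ+M≡L₁) ,
                                   ≤-trans (+-mono-≤ M≤r M≤L₂∸r) (≤-reflexive (m+[n∸m]≡n (<⇒≤ r<L₂)))
      where
      ends-lift : w₂ (X + r) ≡ w₁ s
      ends-lift = trans w[X+r]≡wX′ lift-end
      M≤r : M ≤ r
      M≤r = ≤-trans (arc-long lift-start ends-lift) (size-segment w₂ X r)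
      M≤L₂∸r : M ≤ L₂ ∸ r
      M≤L₂∸r = ≤-trans (arc-long (trans (W₂.periodic X) lift-start) ends-lift)
                 (≤-trans (≤-reflexive (size-cong (segment-comm w₂ (X + L₂) (X + r))))
                          (size-segment-≡ w₂ (trans (+-assoc X r (L₂ ∸ r)) (cong (X +_) (m+[n∸m]≡n (<⇒≤ r<L₂))))))
      M≤δ : M ≤ δ
      M≤δ = [ ≤-trans M≤r , ≤-trans M≤L₂∸r ]′ (C₂-isometric lift-start ends-lift (<⇒≤ r<L₂))

    Φs : ℕ
    Φs = far X′

    common-t : Common t
    common-t = subst (OnCycle C₂) lift-start (W₂.w-on-C X)

    common-sM : Common (s + M)
    common-sM = subst Common (sym s+M≡t+L₁) (common-+L₁ common-t)

    second-walk : Walk M s Φs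
    second-walk = walk M ≤-refl (Gap.common-end gap) common-sM (trans (far-lift X′) lift-end)
                       (≤-trans (+-monoʳ-≤ L₂ (m∸n≤m L₁ δ)) (far-big X′))

    open Walk second-walk using (end; near; aligned)

    arc : M ≤ size (segment w₂ end Φs)
    arc = arc-long (trans (Walk.lift-end second-walk) (trans (cong w₁ s+M≡t+L₁) (W₁.periodic t)))
                   (trans (far-lift X′) lift-end)

    -- The walk moves at most M, and by arc-long at least M: it is monotone.
    direction : ∃[ d ] Moved d M Φs end
    direction with ≤-total end Φs
    ... | inj₁ end≤Φs = backward , ≤-antisym (proj₂ near) (begin
      end + M             ≤⟨ +-monoʳ-≤ end (≤-trans arc (size-segment-≡ w₂ (m+[n∸m]≡n end≤Φs))) ⟩
      end + (Φs ∸ end)    ≡⟨ m+[n∸m]≡n end≤Φs ⟩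
      Φs                  ∎)
      where open ≤-Reasoning
    ... | inj₂ Φs≤end = forward , ≤-antisym (proj₁ near) (begin
      Φs + M              ≤⟨ +-monoʳ-≤ Φs (≤-trans arc (≤-trans (≤-reflexive (size-cong (segment-comm w₂ end Φs)))
                                                            (size-segment-≡ w₂ (m+[n∸m]≡n Φs≤end)))) ⟩
      Φs + (end ∸ Φs)     ≡⟨ m+[n∸m]≡n Φs≤end ⟩
      end                 ∎)
      where open ≤-Reasoning

    uncommon : ∀ {τ} → M < τ → τ < L₁ → ¬ Common (s + τ)
    uncommon {τ} M<τ τ<L₁ common =
      Gap.between gap (m<n⇒0<n∸m M<τ) j<δ (subst (OnCycle C₂) (trans (cong w₁ s+τ≡) (W₁.periodic (t + j))) common)
      where
      j = τ ∸ M
      M+j≡τ : M + j ≡ τ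
      M+j≡τ = m+[n∸m]≡n (<⇒≤ M<τ)
      j<δ : j < δ
      j<δ = +-cancelˡ-< M j δ (subst₂ _<_ (sym M+j≡τ) (trans (sym δ+M≡L₁) (+-comm δ M)) τ<L₁)
      s+τ≡ : s + τ ≡ t + j + L₁
      s+τ≡ = begin
        s + τ           ≡⟨ cong (s +_) M+j≡τ ⟨
        s + (M + j)     ≡⟨ +-assoc s M j ⟨
        s + M + j       ≡⟨ cong (_+ j) s+M≡t+L₁ ⟩
        t + L₁ + j      ≡⟨ +-right-comm t L₁ j ⟩
        t + j + L₁      ∎
        where open ≡-Reasoning

    common-s0 : Common (s + 0)
    common-s0 = subst Common (sym (+-identityʳ s)) (Gap.common-end gap)

    structure : Structure C₁ C₂
    structure with direction
    ... | forward , moved = Assembly.structure (W₁.rotate s) (W₂.rotate Φs) L₁≤L₂ (proj₁ M-short) (proj₂ M-short)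
                              common-s0 common-sM uncommon (aligned forward moved)
    ... | backward , moved = Assembly.structure (W₁.rotate s) (W₂.reflect Φs) L₁≤L₂ (proj₁ M-short) (proj₂ M-short)
                               common-s0 common-sM uncommon
                               (λ τ≤M common → trans (W₂.w-reverse (≤-trans τ≤M Φs-big)) (aligned backward moved τ≤M common))
      where
      Φs-big : M ≤ Φs
      Φs-big = ≤-trans (m∸n≤m L₁ δ) (≤-trans (m≤n+m L₁ L₂) (far-big X′))

  structure : L₁ ≤ L₂ → ∀ {v} → OnCycle C₁ v → OnCycle C₂ v → Structure C₁ C₂
  structure L₁≤L₂ on₁ on₂ = AroundCriticalGap.structure L₁≤L₂ (critical-gap on₁ on₂)

theorem3 : (G : Graph) (m : ℕ) (B : Fin m → EdgeSet (n G)) → IsMCB G B →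
           (x y : Fin m) → x ≢ y → size (B x) ≤ size (B y) →
           ∃[ v ] (OnCycle (B x) v × OnCycle (B y) v) →
           Structure (B x) (B y)
theorem3 G m B mcb x y x≢y |Bx|≤|By| (v , on-x , on-y)
  with ElementCirculation.circulation G B mcb x on-x | ElementCirculation.circulation G B mcb y on-y
... | L₁ , w₁ , circ₁ | L₂ , w₂ , circ₂ =
  TwoElements.structure G B mcb x≢y circ₁ circ₂
    (subst₂ _≤_ (Circulation.size-C circ₁) (Circulation.size-C circ₂) |Bx|≤|By|) on-x on-y
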